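{- Let $(G,\pi)$ be a parity game, $\tau$ a strategy for Odd, $T$ an ordered tree of height $d/2$, and $\mu:V\to\bar L(T)$ a node labeling such that $G_\tau$ has no loose arcs with respect to $\mu$. Let $H:=G_\tau\setminus\bigcup_{v\in B(G_\tau)}\delta^+(v)$ and consider the procedure Dijkstra which, given $\nu:V\to\bar L(T)$: sets $S:=B(G_\tau)$ and $\nu(v):=\top$ for $v\notin S$; for every arc $vw\in E_\tau$ with $w\in S$, $v\notin S$, sets $\nu(v):=\mathrm{drop}(\nu,vw)$; then, while $S\ne V$, picks $u\in\arg\min_{v\in V\setminus S}\Phi^\nu(v)$ (ties broken arbitrarily), adds $u$ to $S$, and for every arc $vu\in E_\tau$ with $v\notin S$ sets $\nu(v):=\mathrm{drop}(\nu,vu)$; finally returns $\nu$. If the input $\nu$ satisfies $\nu(v)=\mu^{\mathcal{G}^\uparrow_\tau}(v)$ for all $v\in B(G_\tau)$, then Dijkstra returns $\mu^{\mathcal{G}^\uparrow_\tau}$.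
   Context: A parity game: finite directed graph $G=(V,E)$, every node with an outgoing arc, $V=V_0\sqcup V_1$, priorities $\pi:V\to\{1,\dots,d\}$, $d$ even. A strategy for Odd is $\tau:V_1\to V$ with $v\tau(v)\in E$; $G_\tau=(V,E_\tau)$ with $E_\tau=\{vw\in E:v\in V_0\}\cup\{v\tau(v):v\in V_1\}$. An Even strategy $\sigma:V_0\to V$ gives $G_\sigma$ (all arcs out of $V_1$, only $v\sigma(v)$ out of $v\in V_0$). For a subgraph $K$: $\pi(K)$ max priority, $K$ even if $\pi(K)$ even, $\Pi(K)$ nodes of priority $\pi(K)$, $K_p$ induced subgraph on nodes of priority $\le p$, $\delta^+(v)$ outgoing arcs. Base nodes $B(G_\tau)$: nodes in $\Pi(C)$ for some even cycle $C$ of $G_\tau$. Ordered trees: prefix-closed sets of tuples over a linearly ordered set, viewed as rooted trees, ordered lexicographically; leaves of a height-$d/2$ tree are at depth $d/2$, written $\xi=(\xi_{d-1},\dots,\xi_1)$; $\xi|_p$ deletes components with index $<p$; $\bar L(T)=L(T)\cup\{\top\}$, $\top$ maximal, $\top|_p=\top$. For $\nu:V\to\bar L(T)$ (labelings ordered pointwise): arc $vw$ non-violated if ($\pi(v)$ even and $\nu(v)|_{\pi(v)}\ge\nu(w)|_{\pi(v)}$) or ($\pi(v)$ odd and ($\nu(v)|_{\pi(v)}>\nu(w)|_{\pi(v)}$ or $\nu(v)=\nu(w)=\top$)); violated otherwise; tight if $\nu(v)$ is the smallest element of $\bar L(T)$ making $vw$ non-violated when substituted for $\nu(v)$; loose if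 neither. $\nu$ is feasible in a subgraph $K$ if some Even strategy $\sigma$, with $v\sigma(v)\in E(K)$ whenever $v\in V_0$ has an outgoing arc in $K$, makes all arcs of $K$ in $G_\sigma$ non-violated. $\mu^{\mathcal{G}^\uparrow_\tau}$ is the pointwise least labeling $\nu\ge\mu$ feasible in $G_\tau$ (it exists). $\mathrm{drop}(\nu,vw)$ is the largest $\xi\in\bar L(T)$ with $\xi\le\nu(v)$ such that $vw$ is not loose after replacing $\nu(v)$ by $\xi$. Potentials: for each even $p\in[d]$ fix $\Phi_p:V\to\mathbb{Z}_{\ge0}$ with $\Phi_p(v)=0$ iff $\pi(v)>p$; $\Phi_p(v)\ge\Phi_p(w)$ whenever $v$ can reach $w$ in $H_p$; $\Phi_p(v)=\Phi_p(w)>0$ iff $v,w$ are strongly connected in $H_p$. $\Phi^\nu(v):=(\Phi_d(v),\nu(v)_{d-1},\Phi_{d-2}(v),\nu(v)_{d-3},\dots,\Phi_2(v),\nu(v)_1)$ if $\nu(v)\ne\top$ and $\infty$ (larger than all tuples) otherwise, compared lexicographically. -}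

module Defs where

open import Data.Nat using (ℕ; zero; suc; _+_; _*_; _∸_; _≤_; _<_; ⌊_/2⌋; _⊔_; _%_)
open import Data.Fin using (Fin; _≟_)
open import Data.Bool using (Bool; true; false)
open import Data.List using (List; []; _∷_; take; map)
open import Data.List.Membership.Propositional using (_∈_)
open import Data.List.Relation.Unary.Unique.Propositional using (Unique)
open import Data.Vec using (Vec; toList) renaming ([] to []ᵥ; _∷_ to _∷ᵥ_)
open import Data.Product using (Σ; ∃; _×_; _,_)
open import Data.Sum using (_⊎_)
open import Data.Empty using (⊥)
open import Relation.Nullary using (¬_; yes; no)
open import Relation.Binary.PropositionalEquality using (_≡_)
open import Relation.Binary.Construct.Closure.ReflexiveTransitive using (Star)
open import Function.Bundles using (_⇔_)

data Player : Set where
  even odd : Player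

EvenN : ℕ → Set
EvenN p = p % 2 ≡ 0

OddN : ℕ → Set
OddN p = p % 2 ≡ 1

-- Lexicographic order on lists of naturals (used on lists of equal length)

data _<ₗ_ : List ℕ → List ℕ → Set where
  here  : ∀ {x y xs ys} → x < y → (x ∷ xs) <ₗ (y ∷ ys)
  there : ∀ {x xs ys} → xs <ₗ ys → (x ∷ xs) <ₗ (x ∷ ys)

_≤ₗ_ : List ℕ → List ℕ → Set
a ≤ₗ b = a ≡ b ⊎ a <ₗ b

-- Tuples extended by a maximal element ∞ (used for truncated labels
-- ξ|_p with ⊤|_p = ⊤, and for the keys Φ^ν)

data Tup : Set where
  fin : List ℕ → Tup
  ∞   : Tup

data _<ᵗ_ : Tup → Tup → Set where
  fin<fin : ∀ {a b} → a <ₗ b → fin a <ᵗ fin b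
  fin<∞   : ∀ {a} → fin a <ᵗ ∞

_≤ᵗ_ : Tup → Tup → Set
a ≤ᵗ b = a ≡ b ⊎ a <ᵗ b

-- Labels: leaves of an ordered tree of height h (= d/2), plus ⊤.
-- A leaf ξ = (ξ_{d-1}, ξ_{d-3}, …, ξ_1) is a vector of length h.

data L̄ (h : ℕ) : Set where
  leaf : Vec ℕ h → L̄ h
  top  : L̄ h

cut : ∀ {h} → ℕ → L̄ h → Tup
cut k (leaf a) = fin (take k (toList a))
cut k top      = ∞

-- number of components of ξ with (odd) index ≥ p, for d = 2h:
-- ξ|_p keeps exactly these first components
keep : ℕ → ℕ → ℕ
keep h p = ⌊ (2 * h + 1 ∸ p) /2⌋

restr : ∀ {h} → ℕ → L̄ h → Tup
restr {h} p ξ = cut (keep h p) ξ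

_≤L_ : ∀ {h} → L̄ h → L̄ h → Set
_≤L_ {h} ξ ζ = cut h ξ ≤ᵗ cut h ζ

ChainTo : ∀ {n} → (Fin n → Fin n → Set) → Fin n → List (Fin n) → Fin n → Set
ChainTo R a []       z = R a z
ChainTo R a (b ∷ bs) z = R a b × ChainTo R b bs z

Cycle : ∀ {n} → (Fin n → Fin n → Set) → List (Fin n) → Set
Cycle R []       = ⊥
Cycle R (x ∷ xs) = Unique (x ∷ xs) × ChainTo R x xs x

-- Everything relative to a parity game (E, owner, π) with d = 2h,
-- an Odd strategy τ, an ordered tree T (given by its set of leaves)
-- and potentials Φ (Φ p = Φ_p).

module Game {n : ℕ} (h : ℕ) (E : Fin n → Fin n → Bool) (owner : Fin n → Player)
            (π : Fin n → ℕ) (τ : Fin n → Fin n) (T : List (Vec ℕ h))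
            (Φ : ℕ → Fin n → ℕ) where

  d : ℕ
  d = 2 * h

  Lab : Set
  Lab = Fin n → L̄ h

  Eτ : Fin n → Fin n → Set
  Eτ v w = (owner v ≡ even × E v w ≡ true) ⊎ (owner v ≡ odd × w ≡ τ v)

  InL̄ : L̄ h → Set
  InL̄ ξ = ξ ≡ top ⊎ Σ (Vec ℕ h) (λ a → ξ ≡ leaf a × a ∈ T)

  IsLab : Lab → Set
  IsLab ν = ∀ v → InL̄ (ν v)

  _≤ν_ : Lab → Lab → Set
  ν ≤ν ν' = ∀ v → ν v ≤L ν' v

  upd : Lab → Fin n → L̄ h → Lab
  upd ν v ξ x with x ≟ v
  ... | yes _ = ξ
  ... | no  _ = ν x

  NonViolated : Lab → Fin n → Fin n → Set
  NonViolated ν v w =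
      (EvenN (π v) × restr (π v) (ν w) ≤ᵗ restr (π v) (ν v))
    ⊎ (OddN (π v) × (restr (π v) (ν w) <ᵗ restr (π v) (ν v) ⊎ (ν v ≡ top × ν w ≡ top)))

  Violated : Lab → Fin n → Fin n → Set
  Violated ν v w = ¬ NonViolated ν v w

  Tight : Lab → Fin n → Fin n → Set
  Tight ν v w = InL̄ (ν v) × NonViolated ν v w
              × (∀ ξ → InL̄ ξ → NonViolated (upd ν v ξ) v w → ν v ≤L ξ)

  Loose : Lab → Fin n → Fin n → Set
  Loose ν v w = ¬ Violated ν v w × ¬ Tight ν v w

  IsDrop : Lab → Fin n → Fin n → L̄ h → Set
  IsDrop ν v w ξ = InL̄ ξ × ξ ≤L ν v × ¬ Loose (upd ν v ξ) v w
                 × (∀ ξ' → InL̄ ξ' → ξ' ≤L ν v → ¬ Loose (upd ν v ξ') v w → ξ' ≤L ξ)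

  Feasible : (Fin n → Fin n → Set) → Lab → Set
  Feasible K ν = Σ (Fin n → Fin n) λ σ →
      (∀ v → owner v ≡ even → E v (σ v) ≡ true)
    × (∀ v → owner v ≡ even → (∃ λ w → K v w) → K v (σ v))
    × (∀ v w → K v w → (owner v ≡ odd ⊎ (owner v ≡ even × w ≡ σ v)) → NonViolated ν v w)

  IsLeastFeasibleAbove : Lab → Lab → Set
  IsLeastFeasibleAbove μ μ' =
      IsLab μ' × μ ≤ν μ' × Feasible Eτ μ'
    × (∀ ν → IsLab ν → μ ≤ν ν → Feasible Eτ ν → μ' ≤ν ν)

  maxπ : List (Fin n) → ℕ
  maxπ []       = 0
  maxπ (x ∷ xs) = π x ⊔ maxπ xs

  Base : Fin n → Set
  Base v = Σ (List (Fin n)) λ C → Cycle Eτ C × EvenN (maxπ C) × v ∈ C × π v ≡ maxπ C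

  H : Fin n → Fin n → Set
  H v w = Eτ v w × ¬ Base v

  Hp : ℕ → Fin n → Fin n → Set
  Hp p v w = H v w × π v ≤ p × π w ≤ p

  Reach : ℕ → Fin n → Fin n → Set
  Reach p v w = π v ≤ p × π w ≤ p × Star (Hp p) v w

  StronglyConnected : ℕ → Fin n → Fin n → Set
  StronglyConnected p v w = Reach p v w × Reach p w v

  IsPotential : Set
  IsPotential = ∀ p → EvenN p → 1 ≤ p → p ≤ d →
      (∀ v → (Φ p v ≡ 0) ⇔ (p < π v))
    × (∀ v w → Reach p v w → Φ p w ≤ Φ p v)
    × (∀ v w → (Φ p v ≡ Φ p w × 0 < Φ p v) ⇔ StronglyConnected p v w)

  -- Φ^ν(v) = (Φ_d(v), ν(v)_{d-1}, Φ_{d-2}(v), ν(v)_{d-3}, …, Φ_2(v), ν(v)_1)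
  interleave : Fin n → ℕ → ∀ {m} → Vec ℕ m → List ℕ
  interleave v p []ᵥ       = []
  interleave v p (x ∷ᵥ xs) = Φ p v ∷ x ∷ interleave v (p ∸ 2) xs

  key : Lab → Fin n → Tup
  key ν v with ν v
  ... | leaf a = fin (interleave v d a)
  ... | top    = ∞

  data DropSeq : Lab → List (Fin n × Fin n) → Lab → Set where
    []  : ∀ {ν} → DropSeq ν [] ν
    _∷_ : ∀ {ν v w ξ as ν'} → IsDrop ν v w ξ → DropSeq (upd ν v ξ) as ν'
        → DropSeq ν ((v , w) ∷ as) ν'

  InS : List (Fin n) → Fin n → Set
  InS added v = Base v ⊎ v ∈ added

  -- the while-loop; each run corresponds to a choice of tie-breaking and of
  -- the order in which the arcs are processed
  data Loop (added : List (Fin n)) (ν : Lab) : Lab → Set where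
    done : (∀ v → InS added v) → Loop added ν ν
    step : ∀ {ν' out} (u : Fin n) (vs : List (Fin n))
         → ¬ InS added u
         → (∀ v → ¬ InS added v → key ν u ≤ᵗ key ν v)
         → Unique vs
         → (∀ v → (v ∈ vs) ⇔ (Eτ v u × ¬ InS (u ∷ added) v))
         → DropSeq ν (map (λ v → (v , u)) vs) ν'
         → Loop (u ∷ added) ν' out
         → Loop added ν out

  Dijkstra : Lab → Lab → Set
  Dijkstra ν out = Σ Lab λ ν₁ →
      (∀ v → (Base v → ν₁ v ≡ ν v) × (¬ Base v → ν₁ v ≡ top))
    × Σ (List (Fin n × Fin n)) λ as →
        Unique as
      × (∀ v w → ((v , w) ∈ as) ⇔ (Eτ v w × Base w × ¬ Base v))
      × Σ Lab λ ν₂ → DropSeq ν₁ as ν₂ × Loop [] ν₂ out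

module Submission where

-- Fix a strategy witnessing the feasibility of μ↑; its choices give every node a successor. Dijkstra keeps
-- the invariant that ν ≥ μ↑, that ν = μ↑ on the settled set S, and that ν(v) is at most the tight value of
-- every arc vw from outside into S. Drops preserve it, since by minimality of μ↑ (and as μ has no loose
-- arcs) μ↑(v) never exceeds the tight value of an arc vw with ν(w) = μ↑(w).
-- The node u of minimal key outside S is settled: if μ↑(u) < ν(u), follow successors from u. They cannot
-- close a cycle outside S (at its maximal priority an even cycle would consist of base nodes, an odd one
-- would make μ↑ decrease strictly around it), so they leave S at some x, where ν(x) = μ↑(x). Comparing the
-- keys of u and x level by level from the top, equal potentials Φ_p keep the walk inside a strongly
-- connected component of H_p without nodes of priority p; then μ↑ cannot increase along it at the next
-- label component, which forces the components of ν(u), ν(x) and μ↑(u) to agree, until an odd priority on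
-- the walk or the last level contradicts μ↑(u) < ν(u).

open import Defs
open import Data.Nat using (ℕ; zero; suc; _+_; _*_; _∸_; _≤_; _<_; _⊓_; _%_; ⌊_/2⌋; z≤n; s≤s)
import Data.Nat.Properties as ℕ
import Data.Nat.DivMod as ℕ
open import Data.Nat.Tactic.RingSolver using (solve-∀)
open import Data.Fin using (Fin; zero; suc; _≟_; toℕ)
import Data.Fin.Properties as Fin
open import Data.Bool using (Bool; true)
import Data.Bool as Bool
open import Data.Product using (Σ; ∃; _×_; _,_; proj₁; proj₂)
open import Data.Sum using (_⊎_; inj₁; inj₂; [_,_]′; map₂)
open import Data.Empty using (⊥; ⊥-elim)
open import Data.List
  using (List; []; _∷_; _++_; take; length; map; lookup; cartesianProductWith; cartesianProduct; allFin; filter)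
import Data.List.Properties as List
open import Data.List.Membership.Propositional using (_∈_; _∉_; lose)
open import Data.List.Membership.Propositional.Properties
  using (∈-∃++; ∈-lookup; ∈-cartesianProductWith⁺; ∈-cartesianProduct⁺; ∈-allFin; ∈-filter⁺; ∈-filter⁻; ∈-map⁺; ∈-map⁻)
open import Data.List.Relation.Unary.All using (All; []; _∷_)
import Data.List.Relation.Unary.All as All
import Data.List.Relation.Unary.All.Properties as All
open import Data.List.Relation.Unary.All.Properties using (¬Any⇒All¬)
open import Data.List.Relation.Unary.Any using (Any; here; there; satisfied)
import Data.List.Relation.Unary.Any as Any
open import Data.List.Relation.Unary.AllPairs using ([]; _∷_)
open import Data.List.Relation.Unary.Unique.Propositional using (Unique)
import Data.List.Relation.Unary.Unique.Propositional.Properties as Unique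
open import Data.Vec using (Vec; toList)
import Data.Vec as Vec
import Data.Vec.Properties as Vec
open import Function.Base using (_∘_)
open import Function.Bundles using (_⇔_; mk⇔; Equivalence)
open Equivalence using (to; from)
open import Relation.Binary.Construct.Closure.ReflexiveTransitive using (Star; ε; _◅_; _◅◅_)
import Relation.Binary.Construct.Closure.ReflexiveTransitive as Star
open import Relation.Binary.Definitions using (Tri; tri<; tri≈; tri>)
open import Relation.Binary.PropositionalEquality using (_≡_; _≢_; refl; sym; trans; cong; subst; subst₂)
open import Relation.Nullary using (¬_; Dec; yes; no)
open import Relation.Nullary.Decidable using (_×-dec_; _⊎-dec_; ¬?; map′; decidable-stable)
open import Relation.Unary using (Decidable)

<ₗ-irrefl : ∀ {a} → ¬ (a <ₗ a)
<ₗ-irrefl (here x<x) = ℕ.<-irrefl refl x<x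
<ₗ-irrefl (there a<a) = <ₗ-irrefl a<a

<ₗ-trans : ∀ {a b c} → a <ₗ b → b <ₗ c → a <ₗ c
<ₗ-trans (here p) (here q) = here (ℕ.<-trans p q)
<ₗ-trans (here p) (there _) = here p
<ₗ-trans (there _) (here q) = here q
<ₗ-trans (there p) (there q) = there (<ₗ-trans p q)

<ₗ-asym : ∀ {a b} → a <ₗ b → ¬ (b <ₗ a)
<ₗ-asym p q = <ₗ-irrefl (<ₗ-trans p q)

compareₗ : ∀ a b → length a ≡ length b → Tri (a <ₗ b) (a ≡ b) (b <ₗ a)
compareₗ [] [] _ = tri≈ (λ ()) refl (λ ())
compareₗ (x ∷ a) (y ∷ b) eq with ℕ.<-cmp x y
... | tri< x<y _ _ = tri< (here x<y) (λ { refl → ℕ.<-irrefl refl x<y }) (<ₗ-asym (here x<y))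
... | tri> _ _ y<x = tri> (<ₗ-asym (here y<x)) (λ { refl → ℕ.<-irrefl refl y<x }) (here y<x)
... | tri≈ _ refl _ with compareₗ a b (ℕ.suc-injective eq)
...   | tri< a<b _ _ = tri< (there a<b) (λ { refl → <ₗ-irrefl a<b }) (<ₗ-asym (there a<b))
...   | tri≈ _ refl _ = tri≈ <ₗ-irrefl refl <ₗ-irrefl
...   | tri> _ _ b<a = tri> (<ₗ-asym (there b<a)) (λ { refl → <ₗ-irrefl b<a }) (there b<a)

take-≤ₗ : ∀ k {a b} → a ≤ₗ b → take k a ≤ₗ take k b
take-≤ₗ k (inj₁ refl) = inj₁ refl
take-≤ₗ zero (inj₂ _) = inj₁ refl
take-≤ₗ (suc k) (inj₂ (here p)) = inj₂ (here p)
take-≤ₗ (suc k) (inj₂ (there p)) with take-≤ₗ k (inj₂ p)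
... | inj₁ eq = inj₁ (cong (_ ∷_) eq)
... | inj₂ q = inj₂ (there q)

≤ₗ-head : ∀ {x y a b} → (x ∷ a) ≤ₗ (y ∷ b) → x ≤ y
≤ₗ-head (inj₁ refl) = ℕ.≤-refl
≤ₗ-head (inj₂ (here p)) = ℕ.<⇒≤ p
≤ₗ-head (inj₂ (there _)) = ℕ.≤-refl

≤ₗ-tail : ∀ {x a b} → (x ∷ a) ≤ₗ (x ∷ b) → a ≤ₗ b
≤ₗ-tail (inj₁ refl) = inj₁ refl
≤ₗ-tail (inj₂ (here p)) = ⊥-elim (ℕ.<-irrefl refl p)
≤ₗ-tail (inj₂ (there p)) = inj₂ p

<ₗ-head : ∀ {x y a b} → (x ∷ a) <ₗ (y ∷ b) → x ≤ y
<ₗ-head (here p) = ℕ.<⇒≤ p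
<ₗ-head (there _) = ℕ.≤-refl

<ₗ-tail : ∀ {x a b} → (x ∷ a) <ₗ (x ∷ b) → a <ₗ b
<ₗ-tail (here p) = ⊥-elim (ℕ.<-irrefl refl p)
<ₗ-tail (there p) = p

++-cancelˡ-≤ₗ : ∀ c {a b} → (c ++ a) ≤ₗ (c ++ b) → a ≤ₗ b
++-cancelˡ-≤ₗ [] p = p
++-cancelˡ-≤ₗ (x ∷ c) p = ++-cancelˡ-≤ₗ c (≤ₗ-tail p)

<ᵗ-irrefl : ∀ {a} → ¬ (a <ᵗ a)
<ᵗ-irrefl (fin<fin p) = <ₗ-irrefl p

<ᵗ-trans : ∀ {a b c} → a <ᵗ b → b <ᵗ c → a <ᵗ c
<ᵗ-trans (fin<fin p) (fin<fin q) = fin<fin (<ₗ-trans p q)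
<ᵗ-trans (fin<fin _) fin<∞ = fin<∞

≤ᵗ-trans : ∀ {a b c} → a ≤ᵗ b → b ≤ᵗ c → a ≤ᵗ c
≤ᵗ-trans (inj₁ refl) q = q
≤ᵗ-trans (inj₂ p) (inj₁ refl) = inj₂ p
≤ᵗ-trans (inj₂ p) (inj₂ q) = inj₂ (<ᵗ-trans p q)

≤ᵗ-<ᵗ-trans : ∀ {a b c} → a ≤ᵗ b → b <ᵗ c → a <ᵗ c
≤ᵗ-<ᵗ-trans (inj₁ refl) q = q
≤ᵗ-<ᵗ-trans (inj₂ p) q = <ᵗ-trans p q

<ᵗ-≤ᵗ-trans : ∀ {a b c} → a <ᵗ b → b ≤ᵗ c → a <ᵗ c
<ᵗ-≤ᵗ-trans p (inj₁ refl) = p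
<ᵗ-≤ᵗ-trans p (inj₂ q) = <ᵗ-trans p q

<ᵗ⇒≱ᵗ : ∀ {a b} → a <ᵗ b → ¬ (b ≤ᵗ a)
<ᵗ⇒≱ᵗ p q = <ᵗ-irrefl (<ᵗ-≤ᵗ-trans p q)

∞≤ᵗ⇒≡∞ : ∀ {a} → ∞ ≤ᵗ a → a ≡ ∞
∞≤ᵗ⇒≡∞ (inj₁ refl) = refl

fin-≤ᵗ⁻ : ∀ {a b} → fin a ≤ᵗ fin b → a ≤ₗ b
fin-≤ᵗ⁻ (inj₁ refl) = inj₁ refl
fin-≤ᵗ⁻ (inj₂ (fin<fin p)) = inj₂ p

fin-≤ᵗ⁺ : ∀ {a b} → a ≤ₗ b → fin a ≤ᵗ fin b
fin-≤ᵗ⁺ (inj₁ refl) = inj₁ refl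
fin-≤ᵗ⁺ (inj₂ p) = inj₂ (fin<fin p)

++-cancelˡ-<ₗ : ∀ c {a b} → (c ++ a) <ₗ (c ++ b) → a <ₗ b
++-cancelˡ-<ₗ [] p = p
++-cancelˡ-<ₗ (x ∷ c) p = ++-cancelˡ-<ₗ c (<ₗ-tail p)

fin-injective : ∀ {a b} → fin a ≡ fin b → a ≡ b
fin-injective refl = refl

fin-<ᵗ⁻ : ∀ {a b} → fin a <ᵗ fin b → a <ₗ b
fin-<ᵗ⁻ (fin<fin p) = p

≤ᵗ-dec : ∀ {a b} → Tri (a <ᵗ b) (a ≡ b) (b <ᵗ a) → Dec (a ≤ᵗ b)
≤ᵗ-dec (tri< a<b _ _) = yes (inj₂ a<b)
≤ᵗ-dec (tri≈ _ a≡b _) = yes (inj₁ a≡b)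
≤ᵗ-dec (tri> _ _ b<a) = no (<ᵗ⇒≱ᵗ b<a)

<ᵗ-dec : ∀ {a b} → Tri (a <ᵗ b) (a ≡ b) (b <ᵗ a) → Dec (a <ᵗ b)
<ᵗ-dec (tri< a<b _ _) = yes a<b
<ᵗ-dec (tri≈ a≮b _ _) = no a≮b
<ᵗ-dec (tri> a≮b _ _) = no a≮b

argmin : ∀ {A : Set} (f : A → Tup) → (∀ x y → f x ≤ᵗ f y ⊎ f y ≤ᵗ f x) → ∀ x xs →
         ∃ λ u → u ∈ x ∷ xs × (∀ {v} → v ∈ x ∷ xs → f u ≤ᵗ f v)
argmin f total x [] = x , here refl , λ { (here refl) → inj₁ refl }
argmin f total x (y ∷ ys) with argmin f total y ys
... | u , u∈ , u≤ with total x u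
...   | inj₁ x≤u = x , here refl , λ { (here refl) → inj₁ refl ; (there v∈) → ≤ᵗ-trans x≤u (u≤ v∈) }
...   | inj₂ u≤x = u , there u∈ , λ { (here refl) → u≤x ; (there v∈) → u≤ v∈ }

module _ {h : ℕ} where

  _<L_ : L̄ h → L̄ h → Set
  x <L y = cut h x <ᵗ cut h y

  take-toList : ∀ (c : Vec ℕ h) → take h (toList c) ≡ toList c
  take-toList c = List.take-all h (toList c) (ℕ.≤-reflexive (Vec.length-toList c))

  compare-cut : ∀ k (x y : L̄ h) → Tri (cut k x <ᵗ cut k y) (cut k x ≡ cut k y) (cut k y <ᵗ cut k x)
  compare-cut k (leaf a) (leaf b) with compareₗ (take k (toList a)) (take k (toList b)) same-length
    where
      same-length : length (take k (toList a)) ≡ length (take k (toList b))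
      same-length = trans (List.length-take k (toList a))
        (trans (cong (k ⊓_) (trans (Vec.length-toList a) (sym (Vec.length-toList b))))
               (sym (List.length-take k (toList b))))
  ... | tri< p q r = tri< (fin<fin p) (λ eq → q (fin-injective eq)) (λ { (fin<fin s) → r s })
  ... | tri≈ p q r = tri≈ (λ { (fin<fin s) → p s }) (cong fin q) (λ { (fin<fin s) → r s })
  ... | tri> p q r = tri> (λ { (fin<fin s) → p s }) (λ eq → q (fin-injective eq)) (fin<fin r)
  compare-cut k (leaf a) top = tri< fin<∞ (λ ()) (λ ())
  compare-cut k top (leaf b) = tri> (λ ()) (λ ()) fin<∞
  compare-cut k top top = tri≈ (λ ()) refl (λ ())

  cut-≤ᵗ : ∀ k {x y : L̄ h} → x ≤L y → cut k x ≤ᵗ cut k y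
  cut-≤ᵗ k {leaf a} {leaf b} x≤y =
    fin-≤ᵗ⁺ (take-≤ₗ k (subst₂ _≤ₗ_ (take-toList a) (take-toList b) (fin-≤ᵗ⁻ x≤y)))
  cut-≤ᵗ k {leaf a} {top} _ = inj₂ fin<∞
  cut-≤ᵗ k {top} {top} _ = inj₁ refl
  cut-≤ᵗ k {top} {leaf b} top≤b with ∞≤ᵗ⇒≡∞ top≤b
  ... | ()

  cut-≤ᵗ-shorter : ∀ {k k'} (x y : L̄ h) → k ≤ k' → cut k' x ≤ᵗ cut k' y → cut k x ≤ᵗ cut k y
  cut-≤ᵗ-shorter {k} {k'} (leaf a) (leaf b) k≤k' p =
    fin-≤ᵗ⁺ (subst₂ _≤ₗ_ (take-prefix a) (take-prefix b) (take-≤ₗ k (fin-≤ᵗ⁻ p)))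
    where
      take-prefix : ∀ (c : Vec ℕ h) → take k (take k' (toList c)) ≡ take k (toList c)
      take-prefix c = trans (List.take-take k k' (toList c)) (cong (λ j → take j (toList c)) (ℕ.m≤n⇒m⊓n≡m k≤k'))
  cut-≤ᵗ-shorter (leaf a) top _ _ = inj₂ fin<∞
  cut-≤ᵗ-shorter top top _ _ = inj₁ refl
  cut-≤ᵗ-shorter top (leaf b) _ p with ∞≤ᵗ⇒≡∞ p
  ... | ()

  cut-prefix : ∀ {c : Vec ℕ h} P y r → toList c ≡ P ++ y ∷ r → cut (suc (length P)) (leaf c) ≡ fin (P ++ y ∷ [])
  cut-prefix P y r c≡ = cong fin (trans (cong (take (suc (length P))) c≡) (take-prefix P))
    where
      take-prefix : ∀ P → take (suc (length P)) (P ++ y ∷ r) ≡ P ++ y ∷ []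
      take-prefix [] = refl
      take-prefix (z ∷ P) = cong (z ∷_) (take-prefix P)

  leaf-injective : ∀ {a b : Vec ℕ h} → leaf a ≡ leaf b → a ≡ b
  leaf-injective refl = refl

  finite⇒leaf : ∀ (x : L̄ h) → x ≢ top → ∃ λ a → x ≡ leaf a
  finite⇒leaf (leaf a) _ = a , refl
  finite⇒leaf top top≢top = ⊥-elim (top≢top refl)

  ≤L-refl : ∀ {x : L̄ h} → x ≤L x
  ≤L-refl = inj₁ refl

  ≤L-trans : ∀ {x y z : L̄ h} → x ≤L y → y ≤L z → x ≤L z
  ≤L-trans = ≤ᵗ-trans

  ≤L-top : ∀ (x : L̄ h) → x ≤L top
  ≤L-top (leaf a) = inj₂ fin<∞
  ≤L-top top = inj₁ refl

  top≤L⇒≡top : ∀ {x : L̄ h} → top ≤L x → x ≡ top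
  top≤L⇒≡top {leaf a} p with ∞≤ᵗ⇒≡∞ p
  ... | ()
  top≤L⇒≡top {top} _ = refl

  ≤L-total : ∀ (x y : L̄ h) → x ≤L y ⊎ y <L x
  ≤L-total x y with compare-cut h x y
  ... | tri< x<y _ _ = inj₁ (inj₂ x<y)
  ... | tri≈ _ x≈y _ = inj₁ (inj₁ x≈y)
  ... | tri> _ _ y<x = inj₂ y<x

  <L⇒≱L : ∀ {x y : L̄ h} → x <L y → ¬ (y ≤L x)
  <L⇒≱L = <ᵗ⇒≱ᵗ

  <L⇒≢top : ∀ {x y : L̄ h} → x <L y → x ≢ top
  <L⇒≢top {y = y} x<y refl = <L⇒≱L x<y (≤L-top y)

  ≤L-antisym : ∀ {x y : L̄ h} → x ≤L y → y ≤L x → x ≡ y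
  ≤L-antisym {leaf a} {leaf b} (inj₁ eq) _ =
    cong leaf (trans (sym (Vec.cast-is-id refl a))
      (Vec.toList-injective refl a b (subst₂ _≡_ (take-toList a) (take-toList b) (fin-injective eq))))
  ≤L-antisym {leaf a} {leaf b} (inj₂ x<y) y≤x = ⊥-elim (<L⇒≱L x<y y≤x)
  ≤L-antisym {leaf a} {top} _ top≤x with ∞≤ᵗ⇒≡∞ top≤x
  ... | ()
  ≤L-antisym {top} {y} top≤y _ = sym (top≤L⇒≡top top≤y)

  infixl 30 _⊓L_
  _⊓L_ : L̄ h → L̄ h → L̄ h
  x ⊓L y with ≤L-total x y
  ... | inj₁ _ = x
  ... | inj₂ _ = y

  ⊓L-≤ˡ : ∀ x y → x ⊓L y ≤L x
  ⊓L-≤ˡ x y with ≤L-total x y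
  ... | inj₁ _ = ≤L-refl
  ... | inj₂ y<x = inj₂ y<x

  ⊓L-≤ʳ : ∀ x y → x ⊓L y ≤L y
  ⊓L-≤ʳ x y with ≤L-total x y
  ... | inj₁ x≤y = x≤y
  ... | inj₂ _ = ≤L-refl

  ⊓L-glb : ∀ {z} x y → z ≤L x → z ≤L y → z ≤L x ⊓L y
  ⊓L-glb x y z≤x z≤y with ≤L-total x y
  ... | inj₁ _ = z≤x
  ... | inj₂ _ = z≤y

  ⊓L-sel : ∀ (P : L̄ h → Set) x y → P x → P y → P (x ⊓L y)
  ⊓L-sel P x y px py with ≤L-total x y
  ... | inj₁ _ = px
  ... | inj₂ _ = py

  LabelIn : List (Vec ℕ h) → L̄ h → Set
  LabelIn as x = x ≡ top ⊎ Σ (Vec ℕ h) (λ a → x ≡ leaf a × a ∈ as)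

  LabelIn-∷ : ∀ {a as x} → LabelIn as x → LabelIn (a ∷ as) x
  LabelIn-∷ (inj₁ eq) = inj₁ eq
  LabelIn-∷ (inj₂ (b , eq , b∈as)) = inj₂ (b , eq , there b∈as)

  leastLabel : {P : L̄ h → Set} → Decidable P → List (Vec ℕ h) → L̄ h
  leastLabel P? [] = top
  leastLabel P? (a ∷ as) with P? (leaf a)
  ... | yes _ = leaf a ⊓L leastLabel P? as
  ... | no _ = leastLabel P? as

  leastLabel-∈ : ∀ {P} (P? : Decidable P) as → LabelIn as (leastLabel P? as)
  leastLabel-∈ P? [] = inj₁ refl
  leastLabel-∈ P? (a ∷ as) with P? (leaf a)
  ... | yes _ = ⊓L-sel (LabelIn (a ∷ as)) (leaf a) _ (inj₂ (a , refl , here refl)) (LabelIn-∷ (leastLabel-∈ P? as))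
  ... | no _ = LabelIn-∷ (leastLabel-∈ P? as)

  leastLabel-satisfies : ∀ {P} (P? : Decidable P) as → P top → P (leastLabel P? as)
  leastLabel-satisfies P? [] Ptop = Ptop
  leastLabel-satisfies {P} P? (a ∷ as) Ptop with P? (leaf a)
  ... | yes Pa = ⊓L-sel P (leaf a) _ Pa (leastLabel-satisfies P? as Ptop)
  ... | no _ = leastLabel-satisfies P? as Ptop

  leastLabel-least : ∀ {P} (P? : Decidable P) {as x} → LabelIn as x → P x → leastLabel P? as ≤L x
  leastLabel-least P? {as} (inj₁ refl) _ = ≤L-top (leastLabel P? as)
  leastLabel-least P? {b ∷ as} (inj₂ (a , refl , a∈)) Pa with P? (leaf b) | a∈
  ... | yes _ | here refl = ⊓L-≤ˡ (leaf a) (leastLabel P? as)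
  ... | yes _ | there a∈as = ≤L-trans (⊓L-≤ʳ (leaf b) _) (leastLabel-least P? (inj₂ (a , refl , a∈as)) Pa)
  ... | no ¬Pb | here refl = ⊥-elim (¬Pb Pa)
  ... | no _ | there a∈as = leastLabel-least P? (inj₂ (a , refl , a∈as)) Pa

parity : ∀ p → EvenN p ⊎ OddN p
parity p with p % 2 | ℕ.m%n<n p 2
... | 0 | _ = inj₁ refl
... | 1 | _ = inj₂ refl
... | suc (suc _) | s≤s (s≤s ())

even⇒¬odd : ∀ {p} → EvenN p → ¬ OddN p
even⇒¬odd e o with trans (sym e) o
... | ()

even-double : ∀ m → EvenN (2 * m)
even-double m = trans (cong (_% 2) (ℕ.*-comm 2 m)) (ℕ.m*n%n≡0 m 2)

odd-double-suc : ∀ m → OddN (suc (2 * m))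
odd-double-suc m = trans (cong (λ k → suc k % 2) (ℕ.*-comm 2 m)) (ℕ.[m+kn]%n≡m%n 1 m 2)

⌊2*n/2⌋≡n : ∀ j → ⌊ 2 * j /2⌋ ≡ j
⌊2*n/2⌋≡n zero = refl
⌊2*n/2⌋≡n (suc j) = trans (cong ⌊_/2⌋ (ℕ.*-suc 2 j)) (cong suc (⌊2*n/2⌋≡n j))

keep-antitone : ∀ h {p q} → p ≤ q → keep h q ≤ keep h p
keep-antitone h p≤q = ℕ.⌊n/2⌋-mono (ℕ.∸-monoʳ-≤ (2 * h + 1) p≤q)

keep-≥ : ∀ h q j → q + 2 * j ≤ 2 * h + 1 → j ≤ keep h q
keep-≥ h q j le = subst (_≤ keep h q) (⌊2*n/2⌋≡n j)
  (ℕ.⌊n/2⌋-mono (ℕ.m+n≤o⇒m≤o∸n (2 * j) (subst (_≤ 2 * h + 1) (ℕ.+-comm q (2 * j)) le)))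

keep-≡ : ∀ h q j → q + 2 * j ≡ 2 * h + 1 → keep h q ≡ j
keep-≡ h q j eq = trans (cong ⌊_/2⌋ (trans (cong (_∸ q) (sym eq)) (ℕ.m+n∸m≡n q (2 * j)))) (⌊2*n/2⌋≡n j)

[1+2m]+2[1+L]≡2[L+1+m]+1 : ∀ L m → suc (2 * m) + 2 * suc L ≡ 2 * (L + suc m) + 1
[1+2m]+2[1+L]≡2[L+1+m]+1 = solve-∀

keep-below-level : ∀ {h L m q} → L + suc m ≡ h → q < 2 * suc m → suc L ≤ keep h q
keep-below-level {h} {L} {m} {q} refl q<p = keep-≥ h q (suc L) (begin
  q + 2 * suc L                 ≤⟨ ℕ.+-monoˡ-≤ (2 * suc L) (ℕ.≤-pred (ℕ.≤-trans q<p (ℕ.≤-reflexive (ℕ.*-suc 2 m)))) ⟩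
  suc (2 * m) + 2 * suc L       ≡⟨ [1+2m]+2[1+L]≡2[L+1+m]+1 L m ⟩
  2 * (L + suc m) + 1           ∎)
  where open ℕ.≤-Reasoning

keep-odd-level : ∀ {h L m} → L + suc m ≡ h → keep h (suc (2 * m)) ≡ suc L
keep-odd-level {h} {L} {m} refl = keep-≡ h (suc (2 * m)) (suc L) ([1+2m]+2[1+L]≡2[L+1+m]+1 L m)

level-below : ∀ {q m} → q < 2 * suc m → suc q ≢ 2 * suc m → q ≤ 2 * suc m ∸ 2
level-below {q} {m} q<p q+1≢p = subst (q ≤_) (sym (cong (_∸ 2) p≡)) (ℕ.≤-pred (ℕ.≤∧≢⇒< q≤ q≢))
  where
    p≡ : 2 * suc m ≡ suc (suc (2 * m))
    p≡ = ℕ.*-suc 2 m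
    q≤ : q ≤ suc (2 * m)
    q≤ = ℕ.≤-pred (subst (suc q ≤_) p≡ q<p)
    q≢ : q ≢ suc (2 * m)
    q≢ q≡ = q+1≢p (trans (cong suc q≡) (sym p≡))

level-odd : ∀ {q m} → suc q ≡ 2 * suc m → q ≡ suc (2 * m)
level-odd {m = m} eq = ℕ.suc-injective (trans eq (ℕ.*-suc 2 m))

-- Non-violation of an arc vw, in terms of p = π(v), x = ν(v) and y = ν(w)

module _ {h : ℕ} where

  NonViolatedAt : ℕ → L̄ h → L̄ h → Set
  NonViolatedAt p x y =
      (EvenN p × restr p y ≤ᵗ restr p x)
    ⊎ (OddN p × (restr p y <ᵗ restr p x ⊎ (x ≡ top × y ≡ top)))

  _≟top : (x : L̄ h) → Dec (x ≡ top)
  leaf a ≟top = no λ ()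
  top ≟top = yes refl

  nonViolatedAt? : ∀ p y → Decidable (λ x → NonViolatedAt p x y)
  nonViolatedAt? p y x =
        ((p % 2 ℕ.≟ 0) ×-dec ≤ᵗ-dec (compare-cut (keep h p) y x))
    ⊎-dec ((p % 2 ℕ.≟ 1) ×-dec (<ᵗ-dec (compare-cut (keep h p) y x) ⊎-dec ((x ≟top) ×-dec (y ≟top))))

  NonViolatedAt-top : ∀ p y → NonViolatedAt p top y
  NonViolatedAt-top p y with parity p | y
  ... | inj₁ e | y' = inj₁ (e , cut-≤ᵗ _ (≤L-top y'))
  ... | inj₂ o | leaf a = inj₂ (o , inj₁ fin<∞)
  ... | inj₂ o | top = inj₂ (o , inj₂ (refl , refl))

  NonViolatedAt-monoˡ : ∀ p {x x' y} → NonViolatedAt p x y → x ≤L x' → NonViolatedAt p x' y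
  NonViolatedAt-monoˡ _ (inj₁ (e , y≤x)) x≤x' = inj₁ (e , ≤ᵗ-trans y≤x (cut-≤ᵗ _ x≤x'))
  NonViolatedAt-monoˡ _ (inj₂ (o , inj₁ y<x)) x≤x' = inj₂ (o , inj₁ (<ᵗ-≤ᵗ-trans y<x (cut-≤ᵗ _ x≤x')))
  NonViolatedAt-monoˡ _ (inj₂ (o , inj₂ (refl , refl))) top≤x' = inj₂ (o , inj₂ (top≤L⇒≡top top≤x' , refl))

  NonViolatedAt-antitoneʳ : ∀ p {x y y'} → NonViolatedAt p x y' → y ≤L y' → NonViolatedAt p x y
  NonViolatedAt-antitoneʳ _ (inj₁ (e , y'≤x)) y≤y' = inj₁ (e , ≤ᵗ-trans (cut-≤ᵗ _ y≤y') y'≤x)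
  NonViolatedAt-antitoneʳ _ (inj₂ (o , inj₁ y'<x)) y≤y' = inj₂ (o , inj₁ (≤ᵗ-<ᵗ-trans (cut-≤ᵗ _ y≤y') y'<x))
  NonViolatedAt-antitoneʳ _ {y = leaf a} (inj₂ (o , inj₂ (refl , refl))) _ = inj₂ (o , inj₁ fin<∞)
  NonViolatedAt-antitoneʳ _ {y = top} (inj₂ (o , inj₂ (refl , refl))) _ = inj₂ (o , inj₂ (refl , refl))

  NonViolatedAt-top⇒top : ∀ p {x} → NonViolatedAt p x top → x ≡ top
  NonViolatedAt-top⇒top _ {x = leaf a} (inj₁ (_ , ∞≤x)) with ∞≤ᵗ⇒≡∞ ∞≤x
  ... | ()
  NonViolatedAt-top⇒top _ {x = top} (inj₁ _) = refl
  NonViolatedAt-top⇒top _ (inj₂ (_ , inj₂ (x≡top , _))) = x≡top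

  NonViolatedAt-cut : ∀ p {x y} k → k ≤ keep h p → NonViolatedAt p x y → cut k y ≤ᵗ cut k x
  NonViolatedAt-cut _ {x = x} {y} k k≤ (inj₁ (_ , y≤x)) = cut-≤ᵗ-shorter y x k≤ y≤x
  NonViolatedAt-cut _ {x = x} {y} k k≤ (inj₂ (_ , inj₁ y<x)) = cut-≤ᵗ-shorter y x k≤ (inj₂ y<x)
  NonViolatedAt-cut _ k _ (inj₂ (_ , inj₂ (refl , refl))) = inj₁ refl

  NonViolatedAt-cut-odd : ∀ p {x y} → OddN p → x ≢ top → NonViolatedAt p x y →
                          cut (keep h p) y <ᵗ cut (keep h p) x
  NonViolatedAt-cut-odd p o _ (inj₁ (e , _)) = ⊥-elim (even⇒¬odd {p} e o)
  NonViolatedAt-cut-odd _ _ _ (inj₂ (_ , inj₁ y<x)) = y<x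
  NonViolatedAt-cut-odd _ _ x≢top (inj₂ (_ , inj₂ (x≡top , _))) = ⊥-elim (x≢top x≡top)

private
  variable
    A : Set
    R R' : A → A → Set
    P : A → Set

_↾_ : (A → A → Set) → (A → Set) → A → A → Set
(R ↾ P) x y = R x y × P x × P y

sources : ∀ {a b : A} → Star R a b → List A
sources ε = []
sources (_◅_ {i = x} _ s) = x ∷ sources s

All-sources : (∀ {x y} → R x y → P x) → ∀ {a b : A} (s : Star R a b) → All P (sources s)
All-sources f ε = []
All-sources f (r ◅ s) = f r ∷ All-sources f s

propagate : (∀ {x y} → R x y → P x → P y) → ∀ {a b : A} (s : Star R a b) → P a → All P (sources s) × P b
propagate f ε Pa = [] , Pa
propagate f (r ◅ s) Pa = let Ps , Pb = propagate f s (f r Pa) in Pa ∷ Ps , Pb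

restrict : ∀ {a b : A} (s : Star R a b) → All P (sources s) → P b → Star (R ↾ P) a b
restrict ε _ _ = ε
restrict (r ◅ ε) (Pa ∷ []) Pb = (r , Pa , Pb) ◅ ε
restrict (r ◅ s@(_ ◅ _)) (Pa ∷ Ps@(Px ∷ _)) Pb = (r , Pa , Px) ◅ restrict s Ps Pb

sources-restrict : ∀ {a b : A} (s : Star R a b) (Ps : All P (sources s)) (Pb : P b) → sources (restrict s Ps Pb) ≡ sources s
sources-restrict ε _ _ = refl
sources-restrict (r ◅ ε) (_ ∷ []) _ = refl
sources-restrict (r ◅ s@(_ ◅ _)) (_ ∷ Ps@(_ ∷ _)) Pb = cong (_ ∷_) (sources-restrict s Ps Pb)

sources-map : (f : ∀ {x y} → R x y → R' x y) → ∀ {a b : A} (s : Star R a b) → sources (Star.map f s) ≡ sources s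
sources-map f ε = refl
sources-map f (r ◅ s) = cong (_ ∷_) (sources-map f s)

split-at-source : ∀ {a b : A} (s : Star R a b) → Any P (sources s) → ∃ λ y → P y × Star R a y × ∃ λ y' → R y y' × Star R y' b
split-at-source (r ◅ s) (here Py) = _ , Py , ε , _ , r , s
split-at-source (r ◅ s) (there any) =
  let y , Py , pre , y' , r' , suf = split-at-source s any in y , Py , r ◅ pre , y' , r' , suf

module _ {n : ℕ} where

  HasDuplicate : List (Fin n) → Set
  HasDuplicate xs = ∃ λ p → ∃ λ q → ∃ λ r → ∃ λ a → xs ≡ p ++ a ∷ q ++ a ∷ r

  unique⊎hasDuplicate : (xs : List (Fin n)) → Unique xs ⊎ HasDuplicate xs
  unique⊎hasDuplicate [] = inj₁ []
  unique⊎hasDuplicate (x ∷ xs) with Any.any? (x ≟_) xs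
  ... | yes x∈xs = let q , r , eq = ∈-∃++ x∈xs in inj₂ ([] , q , r , x , cong (x ∷_) eq)
  ... | no x∉xs with unique⊎hasDuplicate xs
  ...   | inj₁ u = inj₁ (¬Any⇒All¬ xs x∉xs ∷ u)
  ...   | inj₂ (p , q , r , a , eq) = inj₂ (x ∷ p , q , r , a , cong (x ∷_) eq)

  unique⇒length≤ : ∀ {xs : List (Fin n)} → Unique xs → length xs ≤ n
  unique⇒length≤ {xs} u with length xs ℕ.≤? n
  ... | yes ≤n = ≤n
  ... | no ≰n with Fin.pigeonhole (ℕ.≰⇒> ≰n) (lookup xs)
  ...   | i , j , i<j , eq = ⊥-elim (ℕ.<-irrefl (cong toℕ (lookup-injective u i j eq)) i<j)
    where
      lookup-injective : ∀ {xs : List (Fin n)} → Unique xs → ∀ i j → lookup xs i ≡ lookup xs j → i ≡ j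
      lookup-injective {_ ∷ _} _ zero zero _ = refl
      lookup-injective (x∉ ∷ _) zero (suc j) eq = ⊥-elim (All.lookup x∉ (∈-lookup j) eq)
      lookup-injective (x∉ ∷ _) (suc i) zero eq = ⊥-elim (All.lookup x∉ (∈-lookup i) (sym eq))
      lookup-injective (_ ∷ u) (suc i) (suc j) eq = cong suc (lookup-injective u i j eq)

  listsUpTo : ℕ → List (List (Fin n))
  listsUpTo zero = [] ∷ []
  listsUpTo (suc k) = [] ∷ cartesianProductWith _∷_ (allFin n) (listsUpTo k)

  ∈-listsUpTo : ∀ {k} (xs : List (Fin n)) → length xs ≤ k → xs ∈ listsUpTo k
  ∈-listsUpTo {zero} [] _ = here refl
  ∈-listsUpTo {suc k} [] _ = here refl
  ∈-listsUpTo {suc k} (x ∷ xs) (s≤s ≤k) = there (∈-cartesianProductWith⁺ _∷_ (∈-allFin x) (∈-listsUpTo xs ≤k))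

  chainTo-split : ∀ {a b : Fin n} q m r →
                  ChainTo R a (q ++ m ∷ r) b → ChainTo R a q m × ChainTo R m r b
  chainTo-split [] m r c = c
  chainTo-split (_ ∷ q) m r (ra , c) = let c₁ , c₂ = chainTo-split q m r c in (ra , c₁) , c₂

  chainTo-join : ∀ {a b : Fin n} q m r →
                 ChainTo R a q m → ChainTo R m r b → ChainTo R a (q ++ m ∷ r) b
  chainTo-join [] m r c₁ c₂ = c₁ , c₂
  chainTo-join (_ ∷ q) m r (ra , c₁) c₂ = ra , chainTo-join q m r c₁ c₂

  toChainTo : ∀ {z a b : Fin n} → (R ↾ P) z a → Star (R ↾ P) a b → ∃ λ bs → ChainTo R z bs b × All P bs
  toChainTo (r , _) ε = [] , r , []
  toChainTo {a = a} (r , _ , Pa) (r' ◅ s) = let bs , c , Pbs = toChainTo r' s in a ∷ bs , (r , c) , Pa ∷ Pbs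

  -- Cutting out the part between two visits of the same node keeps a closed walk closed.
  simple-closed-walk : ∀ {z : Fin n} bs → ChainTo R z bs z → All P bs → ∃ λ bs' → Unique (z ∷ bs') × ChainTo R z bs' z × All P bs'
  simple-closed-walk {R = R} {P = P} {z} bs = go (suc (length bs)) bs ℕ.≤-refl
    where
      shorter₁ : ∀ (q r : List (Fin n)) a → length q < length (q ++ a ∷ r)
      shorter₁ [] r a = s≤s z≤n
      shorter₁ (_ ∷ q) r a = s≤s (shorter₁ q r a)

      shorter₂ : ∀ (p q r : List (Fin n)) a → length (p ++ a ∷ r) < length (p ++ a ∷ q ++ a ∷ r)
      shorter₂ [] q r a = s≤s (suffix-shorter q)
        where
          suffix-shorter : ∀ q → length r < length (q ++ a ∷ r)
          suffix-shorter [] = ℕ.≤-refl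
          suffix-shorter (_ ∷ q) = ℕ.m≤n⇒m≤1+n (suffix-shorter q)
      shorter₂ (_ ∷ p) q r a = s≤s (shorter₂ p q r a)

      go : ∀ k bs → length bs < k → ChainTo R z bs z → All P bs →
           ∃ λ bs' → Unique (z ∷ bs') × ChainTo R z bs' z × All P bs'
      go (suc k) bs bs<k c Pbs with unique⊎hasDuplicate (z ∷ bs)
      ... | inj₁ u = bs , u , c , Pbs
      ... | inj₂ ([] , q , r , _ , refl) =
        go k q (ℕ.<-≤-trans (shorter₁ q r z) (ℕ.≤-pred bs<k)) (proj₁ (chainTo-split q z r c)) (All.++⁻ˡ q Pbs)
      ... | inj₂ (_ ∷ p , q , r , a , refl) =
        let c₁ , c₂ = chainTo-split p a (q ++ a ∷ r) c
            _ , c₃ = chainTo-split q a r c₂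
            Pa∷Pq++Par = All.++⁻ʳ p Pbs
        in go k (p ++ a ∷ r) (ℕ.<-≤-trans (shorter₂ p q r a) (ℕ.≤-pred bs<k)) (chainTo-join p a r c₁ c₃)
              (All.++⁺ (All.++⁻ˡ p Pbs) (All.++⁻ʳ q (All.tail Pa∷Pq++Par)))

_≟ₚ_ : (a b : Player) → Dec (a ≡ b)
even ≟ₚ even = yes refl
even ≟ₚ odd = no λ ()
odd ≟ₚ even = no λ ()
odd ≟ₚ odd = yes refl

module _ {n : ℕ} (h : ℕ) (E : Fin n → Fin n → Bool) (owner : Fin n → Player)
         (π : Fin n → ℕ) (τ : Fin n → Fin n) (T : List (Vec ℕ h))
         (Φ : ℕ → Fin n → ℕ) where

  open Game h E owner π τ T Φ
  open import Data.List.Relation.Unary.Unique.DecPropositional {A = Fin n} _≟_ using (unique?)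

  upd-same : ∀ ν v ξ → upd ν v ξ v ≡ ξ
  upd-same ν v ξ with v ≟ v
  ... | yes _ = refl
  ... | no v≢v = ⊥-elim (v≢v refl)

  upd-other : ∀ ν v ξ {x} → x ≢ v → upd ν v ξ x ≡ ν x
  upd-other ν v ξ {x} x≢v with x ≟ v
  ... | yes x≡v = ⊥-elim (x≢v x≡v)
  ... | no _ = refl

  upd-elim : ∀ (P : L̄ h → Set) ν v ξ x → (x ≡ v → P ξ) → (x ≢ v → P (ν x)) → P (upd ν v ξ x)
  upd-elim P ν v ξ x Pξ Pνx with x ≟ v
  ... | yes x≡v = Pξ x≡v
  ... | no x≢v = Pνx x≢v

  upd-≤ : ∀ {ν v ξ} → ξ ≤L ν v → upd ν v ξ ≤ν ν
  upd-≤ {ν} {v} {ξ} ξ≤ x = upd-elim (_≤L ν x) ν v ξ x (λ { refl → ξ≤ }) (λ _ → ≤L-refl)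

  upd-isLab : ∀ {ν ξ} v → IsLab ν → InL̄ ξ → IsLab (upd ν v ξ)
  upd-isLab {ν} {ξ} v ν∈ ξ∈ x = upd-elim InL̄ ν v ξ x (λ _ → ξ∈) (λ _ → ν∈ x)

  -- Tight values and drops

  tightLabel : ℕ → L̄ h → L̄ h
  tightLabel p y = leastLabel (nonViolatedAt? p y) T

  tightLabel-∈ : ∀ p y → InL̄ (tightLabel p y)
  tightLabel-∈ p y = leastLabel-∈ (nonViolatedAt? p y) T

  tightLabel-nonViolated : ∀ p y → NonViolatedAt p (tightLabel p y) y
  tightLabel-nonViolated p y = leastLabel-satisfies (nonViolatedAt? p y) T (NonViolatedAt-top p y)

  tightLabel-least : ∀ p {x y} → InL̄ x → NonViolatedAt p x y → tightLabel p y ≤L x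
  tightLabel-least p {y = y} = leastLabel-least (nonViolatedAt? p y)

  tightLabel-mono : ∀ p {y y'} → y ≤L y' → tightLabel p y ≤L tightLabel p y'
  tightLabel-mono p {y' = y'} y≤y' =
    tightLabel-least p (tightLabel-∈ p y') (NonViolatedAt-antitoneʳ p (tightLabel-nonViolated p y') y≤y')

  tightAt : Lab → Fin n → Fin n → L̄ h
  tightAt ν v w = tightLabel (π v) (ν w)

  module _ {v w : Fin n} (w≢v : w ≢ v) where

    tightAt-upd : ∀ {ν} ξ → tightAt (upd ν v ξ) v w ≡ tightAt ν v w
    tightAt-upd {ν} ξ = cong (tightLabel (π v)) (upd-other ν v ξ w≢v)

    nonViolated-upd⇔ : ∀ {ν} ξ → NonViolated (upd ν v ξ) v w ⇔ NonViolatedAt (π v) ξ (ν w)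
    nonViolated-upd⇔ {ν} ξ =
      mk⇔ (subst₂ (NonViolatedAt (π v)) (upd-same ν v ξ) (upd-other ν v ξ w≢v))
          (subst₂ (NonViolatedAt (π v)) (sym (upd-same ν v ξ)) (sym (upd-other ν v ξ w≢v)))

    loose⇔tightAt< : ∀ {ν} → InL̄ (ν v) → Loose ν v w ⇔ tightAt ν v w <L ν v
    loose⇔tightAt< {ν} νv∈ = mk⇔ tightAt< loose
      where
        tight : ν v ≡ tightAt ν v w → Tight ν v w
        tight eq = νv∈ , subst (λ x → NonViolatedAt (π v) x (ν w)) (sym eq) (tightLabel-nonViolated (π v) (ν w))
                 , λ ξ ξ∈ nv → subst (_≤L ξ) (sym eq) (tightLabel-least (π v) ξ∈ (to (nonViolated-upd⇔ {ν} ξ) nv))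

        tightAt< : Loose ν v w → tightAt ν v w <L ν v
        tightAt< (¬violated , ¬tight) with ≤L-total (ν v) (tightAt ν v w)
        ... | inj₂ t<νv = t<νv
        ... | inj₁ νv≤t with ≤L-total (tightAt ν v w) (ν v)
        ...   | inj₁ t≤νv = ⊥-elim (¬tight (tight (≤L-antisym νv≤t t≤νv)))
        ...   | inj₂ νv<t = ⊥-elim (¬violated λ nv → <L⇒≱L νv<t (tightLabel-least (π v) νv∈ nv))

        t = tightAt ν v w

        loose : t <L ν v → Loose ν v w
        loose t<νv = (λ violated → violated (NonViolatedAt-monoˡ (π v) (tightLabel-nonViolated (π v) (ν w)) (inj₂ t<νv)))
                   , λ { (_ , _ , least) → <L⇒≱L t<νv (least t (tightLabel-∈ (π v) (ν w))
                                              (from (nonViolated-upd⇔ {ν} t) (tightLabel-nonViolated (π v) (ν w)))) }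

    ¬loose⇔≤tightAt : ∀ {ν} → InL̄ (ν v) → (¬ Loose ν v w) ⇔ ν v ≤L tightAt ν v w
    ¬loose⇔≤tightAt {ν} νv∈ = mk⇔ ≤t ¬loose
      where
        ≤t : ¬ Loose ν v w → ν v ≤L tightAt ν v w
        ≤t ¬loose with ≤L-total (ν v) (tightAt ν v w)
        ... | inj₁ νv≤t = νv≤t
        ... | inj₂ t<νv = ⊥-elim (¬loose (from (loose⇔tightAt< νv∈) t<νv))

        ¬loose : ν v ≤L tightAt ν v w → ¬ Loose ν v w
        ¬loose νv≤t loose = <L⇒≱L (to (loose⇔tightAt< νv∈) loose) νv≤t

    ¬loose-upd⇔≤tightAt : ∀ {ν ξ} → InL̄ ξ → (¬ Loose (upd ν v ξ) v w) ⇔ ξ ≤L tightAt ν v w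
    ¬loose-upd⇔≤tightAt {ν} {ξ} ξ∈ =
      subst₂ (λ x t → (¬ Loose (upd ν v ξ) v w) ⇔ x ≤L t) (upd-same ν v ξ) (tightAt-upd {ν} ξ)
        (¬loose⇔≤tightAt {upd ν v ξ} (subst InL̄ (sym (upd-same ν v ξ)) ξ∈))

    drop-⊓ : ∀ {ν} → InL̄ (ν v) → IsDrop ν v w (ν v ⊓L tightAt ν v w)
    drop-⊓ {ν} νv∈ = ⊓∈ , ⊓L-≤ˡ (ν v) t , from (¬loose-upd⇔≤tightAt {ν} ⊓∈) (⊓L-≤ʳ (ν v) t)
               , λ ξ ξ∈ ξ≤νv ¬loose → ⊓L-glb (ν v) t ξ≤νv (to (¬loose-upd⇔≤tightAt {ν} ξ∈) ¬loose)
      where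
        t = tightAt ν v w
        ⊓∈ : InL̄ (ν v ⊓L t)
        ⊓∈ = ⊓L-sel InL̄ (ν v) t νv∈ (tightLabel-∈ (π v) (ν w))

    drop≡⊓ : ∀ {ν ξ} → InL̄ (ν v) → IsDrop ν v w ξ → ξ ≡ ν v ⊓L tightAt ν v w
    drop≡⊓ {ν} νv∈ (ξ∈ , ξ≤νv , ¬loose , maximal) =
      ≤L-antisym (⊓L-glb (ν v) t ξ≤νv (to (¬loose-upd⇔≤tightAt {ν} ξ∈) ¬loose))
                 (maximal (ν v ⊓L t) ⊓∈ (⊓L-≤ˡ (ν v) t) (from (¬loose-upd⇔≤tightAt {ν} ⊓∈) (⊓L-≤ʳ (ν v) t)))
      where
        t = tightAt ν v w
        ⊓∈ : InL̄ (ν v ⊓L t)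
        ⊓∈ = proj₁ (drop-⊓ {ν} νv∈)

  Eτ? : ∀ v w → Dec (Eτ v w)
  Eτ? v w = ((owner v ≟ₚ even) ×-dec (E v w Bool.≟ true)) ⊎-dec ((owner v ≟ₚ odd) ×-dec (w ≟ τ v))

  chainTo? : ∀ a xs z → Dec (ChainTo Eτ a xs z)
  chainTo? a [] z = Eτ? a z
  chainTo? a (b ∷ bs) z = Eτ? a b ×-dec chainTo? b bs z

  cycle? : Decidable (Cycle Eτ)
  cycle? [] = no λ ()
  cycle? (x ∷ xs) = unique? (x ∷ xs) ×-dec chainTo? x xs x

  base? : Decidable Base
  base? v = map′ (λ any → satisfied any) (λ { (C , isBase) → lose (∈-listsUpTo C (length≤ C (proj₁ isBase))) isBase })
                 (Any.any? baseWith? (listsUpTo n))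
    where
      baseWith? : ∀ C → Dec (Cycle Eτ C × EvenN (maxπ C) × v ∈ C × π v ≡ maxπ C)
      baseWith? C = cycle? C ×-dec (maxπ C % 2 ℕ.≟ 0) ×-dec Any.any? (v ≟_) C ×-dec (π v ℕ.≟ maxπ C)

      length≤ : ∀ C → Cycle Eτ C → length C ≤ n
      length≤ (_ ∷ _) (u , _) = unique⇒length≤ u

  inS? : ∀ added → Decidable (InS added)
  inS? added v = base? v ⊎-dec Any.any? (v ≟_) added

  maxπ-lub : ∀ {p} xs → All (λ x → π x ≤ p) xs → maxπ xs ≤ p
  maxπ-lub [] [] = z≤n
  maxπ-lub (_ ∷ xs) (x≤p ∷ xs≤p) = ℕ.⊔-lub x≤p (maxπ-lub xs xs≤p)

  maxπ-upperBound : ∀ xs → All (λ x → π x ≤ maxπ xs) xs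
  maxπ-upperBound [] = []
  maxπ-upperBound (x ∷ xs) = ℕ.m≤m⊔n (π x) _ ∷ All.map (λ x≤ → ℕ.≤-trans x≤ (ℕ.m≤n⊔m (π x) _)) (maxπ-upperBound xs)

  maxπ-attained : ∀ x xs → Any (λ y → π y ≡ maxπ (x ∷ xs)) (x ∷ xs)
  maxπ-attained x [] = here (sym (ℕ.⊔-identityʳ (π x)))
  maxπ-attained x (y ∷ ys) with ℕ.≤-total (maxπ (y ∷ ys)) (π x)
  ... | inj₁ max≤πx = here (sym (ℕ.m≥n⇒m⊔n≡m max≤πx))
  ... | inj₂ πx≤max = there (Any.map (λ eq → trans eq (sym (ℕ.m≤n⇒m⊔n≡n πx≤max))) (maxπ-attained y ys))

  closedWalk⇒Base : ∀ {p z w} → EvenN p → π z ≡ p → (Eτ ↾ (λ x → π x ≤ p)) z w →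
                    Star (Eτ ↾ (λ x → π x ≤ p)) w z → Base z
  closedWalk⇒Base {p} {z} p-even πz≡p r s =
    let bs , c , bs≤p = toChainTo r s
        bs' , u , c' , bs'≤p = simple-closed-walk bs c bs≤p
        max≡ : maxπ (z ∷ bs') ≡ π z
        max≡ = ℕ.m≥n⇒m⊔n≡m (subst (maxπ bs' ≤_) (sym πz≡p) (maxπ-lub bs' bs'≤p))
    in z ∷ bs' , (u , c') , subst EvenN (sym (trans max≡ πz≡p)) p-even , here refl , sym max≡

  TargetsNotSources : List (Fin n × Fin n) → Set
  TargetsNotSources as = ∀ {v w v' w'} → (v , w) ∈ as → (v' , w') ∈ as → w ≢ v'

  separated⇒targetsNotSources : ∀ {S : Fin n → Set} {as} → (∀ {v w} → (v , w) ∈ as → S w × ¬ S v) →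
                                TargetsNotSources as
  separated⇒targetsNotSources separated vw∈ v'w'∈ refl = proj₂ (separated v'w'∈) (proj₁ (separated vw∈))

  module _ {a : Fin n × Fin n} {as} (disjoint : TargetsNotSources (a ∷ as)) where

    TargetsNotSources-tail : TargetsNotSources as
    TargetsNotSources-tail vw∈ v'w'∈ = disjoint (there vw∈) (there v'w'∈)

    head-loop-free : proj₂ a ≢ proj₁ a
    head-loop-free = disjoint (here refl) (here refl)

    target-not-head : ∀ {v w} → (v , w) ∈ as → w ≢ proj₁ a
    target-not-head vw∈ = disjoint (there vw∈) (here refl)

  dropSeq-exists : ∀ {ν} as → IsLab ν → TargetsNotSources as → ∃ λ ν' → DropSeq ν as ν'
  dropSeq-exists [] _ _ = _ , []
  dropSeq-exists {ν} ((v , w) ∷ as) ν∈ disjoint =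
    let drop = drop-⊓ (head-loop-free disjoint) (ν∈ v)
        ν' , ds = dropSeq-exists as (upd-isLab v ν∈ (proj₁ drop)) (TargetsNotSources-tail disjoint)
    in ν' , drop ∷ ds

  dropSeq-isLab : ∀ {ν as ν'} → DropSeq ν as ν' → IsLab ν → IsLab ν'
  dropSeq-isLab [] ν∈ = ν∈
  dropSeq-isLab (_∷_ {v = v} (ξ∈ , _) ds) ν∈ = dropSeq-isLab ds (upd-isLab v ν∈ ξ∈)

  dropSeq-≤ : ∀ {ν as ν'} → DropSeq ν as ν' → ν' ≤ν ν
  dropSeq-≤ [] x = ≤L-refl
  dropSeq-≤ ((_ , ξ≤νv , _) ∷ ds) x = ≤L-trans (dropSeq-≤ ds x) (upd-≤ ξ≤νv x)

  dropSeq-unchanged : ∀ {ν as ν' x} → DropSeq ν as ν' → (∀ w → (x , w) ∉ as) → ν' x ≡ ν x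
  dropSeq-unchanged [] _ = refl
  dropSeq-unchanged {ν} {x = x} (_∷_ {v = v} {w} {ξ} _ ds) not-source =
    trans (dropSeq-unchanged ds (λ w' → not-source w' ∘ there))
          (upd-other ν v ξ λ { refl → not-source w (here refl) })

  dropSeq-≤tightAt : ∀ {ν as ν' v w} → DropSeq ν as ν' → TargetsNotSources as →
                     (v , w) ∈ as → ν' v ≤L tightAt ν v w
  dropSeq-≤tightAt {ν} (_∷_ {v = v} {w} {ξ} (ξ∈ , _ , ¬loose , _) ds) disjoint (here refl) =
    ≤L-trans (dropSeq-≤ ds v)
      (subst (_≤L tightAt ν v w) (sym (upd-same ν v ξ))
        (to (¬loose-upd⇔≤tightAt (head-loop-free disjoint) ξ∈) ¬loose))
  dropSeq-≤tightAt {ν} {v = v'} (_∷_ {v = v} {ξ = ξ} _ ds) disjoint (there vw∈) =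
    subst (λ y → _ ≤L tightLabel (π v') y) (upd-other ν v ξ (target-not-head disjoint vw∈))
      (dropSeq-≤tightAt ds (TargetsNotSources-tail disjoint) vw∈)

  dropSeq-lower-bound : ∀ {μ ν as ν'} → DropSeq ν as ν' → IsLab ν → TargetsNotSources as → μ ≤ν ν →
                        (∀ {v w} → (v , w) ∈ as → μ v ≤L tightAt ν v w) → μ ≤ν ν'
  dropSeq-lower-bound [] _ _ μ≤ν _ = μ≤ν
  dropSeq-lower-bound {μ} {ν} (_∷_ {v = v} {w} {ξ} drop ds) ν∈ disjoint μ≤ν μ≤t =
    dropSeq-lower-bound ds (upd-isLab v ν∈ (proj₁ drop)) (TargetsNotSources-tail disjoint) μ≤upd
      (λ {v'} {w'} vw∈ → subst (λ y → μ v' ≤L tightLabel (π v') y)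
                           (sym (upd-other ν v ξ (target-not-head disjoint vw∈))) (μ≤t (there vw∈)))
    where
      μ≤upd : μ ≤ν upd ν v ξ
      μ≤upd x = upd-elim (μ x ≤L_) ν v ξ x
        (λ { refl → subst (μ x ≤L_) (sym (drop≡⊓ (head-loop-free disjoint) (ν∈ v) drop))
                      (⊓L-glb (ν v) _ (μ≤ν v) (μ≤t (here refl))) })
        (λ _ → μ≤ν x)

  interleave-length : ∀ v w p q {m} (a b : Vec ℕ m) → length (interleave v p a) ≡ length (interleave w q b)
  interleave-length v w p q Vec.[] Vec.[] = refl
  interleave-length v w p q (_ Vec.∷ a) (_ Vec.∷ b) = cong (λ k → suc (suc k)) (interleave-length v w (p ∸ 2) (q ∸ 2) a b)

  key-cases : ∀ ν v → (ν v ≡ top × key ν v ≡ ∞) ⊎ ∃ λ a → ν v ≡ leaf a × key ν v ≡ fin (interleave v d a)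
  key-cases ν v with ν v
  ... | top = inj₁ (refl , refl)
  ... | leaf a = inj₂ (a , refl , refl)

  key-total : ∀ ν x y → key ν x ≤ᵗ key ν y ⊎ key ν y ≤ᵗ key ν x
  key-total ν x y with ν x | ν y
  ... | top | top = inj₁ (inj₁ refl)
  ... | top | leaf _ = inj₂ (inj₂ fin<∞)
  ... | leaf _ | top = inj₁ (inj₂ fin<∞)
  ... | leaf a | leaf b with compareₗ (interleave x d a) (interleave y d b) (interleave-length x y d d a b)
  ...   | tri< lt _ _ = inj₁ (inj₂ (fin<fin lt))
  ...   | tri≈ _ eq _ = inj₁ (inj₁ (cong fin eq))
  ...   | tri> _ _ gt = inj₂ (inj₂ (fin<fin gt))

  InS-∷ : ∀ {added u v} → InS added v → InS (u ∷ added) v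
  InS-∷ (inj₁ base) = inj₁ base
  InS-∷ (inj₂ v∈) = inj₂ (there v∈)

  argmin-outside : ∀ added ν → Any (λ v → ¬ InS added v) (allFin n) →
                   ∃ λ u → ¬ InS added u × (∀ v → ¬ InS added v → key ν u ≤ᵗ key ν v)
  argmin-outside added ν left with filter (¬? ∘ inS? added) (allFin n) in eq
      | ∈-filter⁺ (¬? ∘ inS? added) (∈-allFin (proj₁ (satisfied left))) (proj₂ (satisfied left))
  ... | x ∷ xs | _ =
    let u , u∈ , u≤ = argmin (key ν) (key-total ν) x xs
        outside : ∀ {v} → v ∈ x ∷ xs → ¬ InS added v
        outside v∈ = proj₂ (∈-filter⁻ (¬? ∘ inS? added) {xs = allFin n} (subst (_ ∈_) (sym eq) v∈))
    in u , outside u∈ , λ v v∉S → u≤ (subst (v ∈_) eq (∈-filter⁺ (¬? ∘ inS? added) (∈-allFin v) v∉S))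

  predsOutside : List (Fin n) → Fin n → List (Fin n)
  predsOutside added u = filter (λ v → Eτ? v u ×-dec ¬? (inS? (u ∷ added) v)) (allFin n)

  ∈-predsOutside⇔ : ∀ added u v → (v ∈ predsOutside added u) ⇔ (Eτ v u × ¬ InS (u ∷ added) v)
  ∈-predsOutside⇔ added u v = mk⇔ (proj₂ ∘ ∈-filter⁻ P? {xs = allFin n}) (∈-filter⁺ P? (∈-allFin v))
    where P? = λ v → Eτ? v u ×-dec ¬? (inS? (u ∷ added) v)

  separated-into : ∀ {added u vs} → (∀ v → (v ∈ vs) ⇔ (Eτ v u × ¬ InS (u ∷ added) v)) →
                   ∀ {v w} → (v , w) ∈ map (_, u) vs → InS (u ∷ added) w × ¬ InS (u ∷ added) v
  separated-into {u = u} vs⇔ vw∈ with ∈-map⁻ (_, u) vw∈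
  ... | v , v∈vs , refl = inj₂ (here refl) , proj₂ (to (vs⇔ v) v∈vs)

  loop-exists : ∀ k added ν → IsLab ν → Unique added → n ≤ k + length added → ∃ λ out → Loop added ν out
  loop-exists k added ν ν∈ unique bound with Any.any? (¬? ∘ inS? added) (allFin n)
  ... | no none-left = ν , done λ v → decidable-stable (inS? added v) (none-left ∘ lose (∈-allFin v))
  ... | yes left with argmin-outside added ν left | k
  ...   | u , u∉S , u-min | zero =
    ⊥-elim (ℕ.<-irrefl refl (ℕ.≤-trans (unique⇒length≤ (¬Any⇒All¬ added (u∉S ∘ inj₂) ∷ unique)) bound))
  ...   | u , u∉S , u-min | suc k =
    let ν' , drops = dropSeq-exists (map (_, u) (predsOutside added u)) ν∈
                       (separated⇒targetsNotSources (separated-into (∈-predsOutside⇔ added u)))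
        out , loop = loop-exists k (u ∷ added) ν' (dropSeq-isLab drops ν∈)
                       (¬Any⇒All¬ added (u∉S ∘ inj₂) ∷ unique)
                       (subst (n ≤_) (sym (ℕ.+-suc k (length added))) bound)
    in out , step u (predsOutside added u) u∉S u-min (Unique.filter⁺ _ (Unique.allFin⁺ n))
                  (∈-predsOutside⇔ added u) drops loop

  BaseRestriction : Lab → Lab → Set
  BaseRestriction ν ν₁ = ∀ v → (Base v → ν₁ v ≡ ν v) × (¬ Base v → ν₁ v ≡ top)

  restrictToBase : Lab → Lab
  restrictToBase ν v with base? v
  ... | yes _ = ν v
  ... | no _ = top

  restrictToBase-spec : ∀ ν → BaseRestriction ν (restrictToBase ν)
  restrictToBase-spec ν v with base? v
  ... | yes base = (λ _ → refl) , (λ ¬base → ⊥-elim (¬base base))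
  ... | no ¬base = (λ base → ⊥-elim (¬base base)) , (λ _ → refl)

  baseRestriction-isLab : ∀ {ν ν₁} → BaseRestriction ν ν₁ → IsLab ν → IsLab ν₁
  baseRestriction-isLab restriction ν∈ v with base? v
  ... | yes base = subst InL̄ (sym (proj₁ (restriction v) base)) (ν∈ v)
  ... | no ¬base = inj₁ (proj₂ (restriction v) ¬base)

  arcsIntoBase : List (Fin n × Fin n)
  arcsIntoBase = filter arcIntoBase? (cartesianProduct (allFin n) (allFin n))
    where arcIntoBase? = λ ((v , w) : Fin n × Fin n) → Eτ? v w ×-dec base? w ×-dec ¬? (base? v)

  ∈-arcsIntoBase⇔ : ∀ v w → ((v , w) ∈ arcsIntoBase) ⇔ (Eτ v w × Base w × ¬ Base v)
  ∈-arcsIntoBase⇔ v w =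
    mk⇔ (proj₂ ∘ ∈-filter⁻ P? {xs = cartesianProduct (allFin n) (allFin n)})
        (∈-filter⁺ P? (∈-cartesianProduct⁺ (∈-allFin v) (∈-allFin w)))
    where P? = λ ((v , w) : Fin n × Fin n) → Eτ? v w ×-dec base? w ×-dec ¬? (base? v)

  dijkstra-exists : ∀ ν → IsLab ν → ∃ λ out → Dijkstra ν out
  dijkstra-exists ν ν∈ =
    let ν₁∈ = baseRestriction-isLab (restrictToBase-spec ν) ν∈
        ν₂ , drops = dropSeq-exists arcsIntoBase ν₁∈
                       (separated⇒targetsNotSources (proj₂ ∘ to (∈-arcsIntoBase⇔ _ _)))
        out , loop = loop-exists n [] ν₂ (dropSeq-isLab drops ν₁∈) [] (ℕ.≤-reflexive (sym (ℕ.+-identityʳ n)))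
    in out , restrictToBase ν , restrictToBase-spec ν , arcsIntoBase
           , Unique.filter⁺ _ (Unique.cartesianProduct⁺ (Unique.allFin⁺ n) (Unique.allFin⁺ n))
           , ∈-arcsIntoBase⇔ , ν₂ , drops , loop

  -- The least feasible labeling μ↑ above μ

  even-arc : ∀ {v w} → Eτ v w → owner v ≡ even → E v w ≡ true
  even-arc (inj₁ (_ , e)) _ = e
  even-arc (inj₂ (is-odd , _)) is-even with trans (sym is-even) is-odd
  ... | ()

  odd-arc : ∀ {v w} → Eτ v w → owner v ≡ odd → w ≡ τ v
  odd-arc (inj₁ (is-even , _)) is-odd with trans (sym is-even) is-odd
  ... | ()
  odd-arc (inj₂ (_ , w≡τv)) _ = w≡τv

  redirect : (Fin n → Fin n) → Fin n → Fin n → Fin n → Fin n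
  redirect σ v w x with x ≟ v
  ... | yes _ = w
  ... | no _ = σ x

  redirect-at : ∀ σ v w → redirect σ v w v ≡ w
  redirect-at σ v w with v ≟ v
  ... | yes _ = refl
  ... | no v≢v = ⊥-elim (v≢v refl)

  redirect-elsewhere : ∀ σ v w {x} → x ≢ v → redirect σ v w x ≡ σ x
  redirect-elsewhere σ v w {x} x≢v with x ≟ v
  ... | yes x≡v = ⊥-elim (x≢v x≡v)
  ... | no _ = refl

  feasible-lower : ∀ {ν v w ξ} → Feasible Eτ ν → Eτ v w → w ≢ v → ξ ≤L ν v → NonViolatedAt (π v) ξ (ν w) →
                   Feasible Eτ (upd ν v ξ)
  feasible-lower {ν} {v} {w} {ξ} (σ , σ-E , σ-Eτ , σ-ok) vw w≢v ξ≤ vw-ok = σ' , σ'-E , σ'-Eτ , σ'-ok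
    where
      σ' = redirect σ v w

      σ'-E : ∀ x → owner x ≡ even → E x (σ' x) ≡ true
      σ'-E x is-even with x ≟ v
      ... | yes refl = even-arc vw is-even
      ... | no _ = σ-E x is-even

      σ'-Eτ : ∀ x → owner x ≡ even → (∃ λ y → Eτ x y) → Eτ x (σ' x)
      σ'-Eτ x is-even out with x ≟ v
      ... | yes refl = vw
      ... | no _ = σ-Eτ x is-even out

      σ'-ok : ∀ x y → Eτ x y → (owner x ≡ odd ⊎ (owner x ≡ even × y ≡ σ' x)) → NonViolated (upd ν v ξ) x y
      σ'-ok x y xy played = by-cases (x ≟ v) played
        where
          by-cases : Dec (x ≡ v) → (owner x ≡ odd ⊎ (owner x ≡ even × y ≡ σ' x)) → NonViolated (upd ν v ξ) x y
          by-cases (yes refl) played = subst (NonViolated (upd ν v ξ) v) w≡y (from (nonViolated-upd⇔ w≢v ξ) vw-ok)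
            where
              w≡y : w ≡ y
              w≡y = [ (λ is-odd → trans (odd-arc vw is-odd) (sym (odd-arc xy is-odd)))
                    , (λ (_ , y≡σ'v) → sym (trans y≡σ'v (redirect-at σ v w))) ]′ played
          by-cases (no x≢v) played =
            subst (λ z → NonViolatedAt (π x) z (upd ν v ξ y)) (sym (upd-other ν v ξ x≢v))
              (NonViolatedAt-antitoneʳ (π x)
                (σ-ok x y xy (map₂ (λ (e , y≡) → e , trans y≡ (redirect-elsewhere σ v w x≢v)) played))
                (upd-≤ ξ≤ y))

  module _ (π-bounds : ∀ v → 1 ≤ π v × π v ≤ d) (potential : IsPotential)
           {μ : Lab} (μ∈ : IsLab μ) (μ-noLoose : ∀ v w → Eτ v w → ¬ Loose μ v w)
           {μ↑ : Lab} (μ↑-least : IsLeastFeasibleAbove μ μ↑) where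

    μ↑∈ : IsLab μ↑
    μ↑∈ = proj₁ μ↑-least

    μ≤μ↑ : μ ≤ν μ↑
    μ≤μ↑ = proj₁ (proj₂ μ↑-least)

    μ↑-feasible : Feasible Eτ μ↑
    μ↑-feasible = proj₁ (proj₂ (proj₂ μ↑-least))

    μ↑-minimal : ∀ ν → IsLab ν → μ ≤ν ν → Feasible Eτ ν → μ↑ ≤ν ν
    μ↑-minimal = proj₂ (proj₂ (proj₂ μ↑-least))

    μ↑≤tightAt : ∀ {v w} → Eτ v w → w ≢ v → μ↑ v ≤L tightAt μ↑ v w
    μ↑≤tightAt {v} {w} vw w≢v with ≤L-total (μ↑ v) (tightAt μ↑ v w)
    ... | inj₁ μ↑v≤t = μ↑v≤t
    ... | inj₂ t<μ↑v = ⊥-elim (<L⇒≱L t<μ↑v (subst (μ↑ v ≤L_) (upd-same μ↑ v t) (μ↑-minimal ν ν∈ μ≤ν ν-feasible v)))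
      where
        t = tightAt μ↑ v w
        ν = upd μ↑ v t
        ν∈ = upd-isLab v μ↑∈ (tightLabel-∈ (π v) (μ↑ w))
        ν-feasible = feasible-lower μ↑-feasible vw w≢v (inj₂ t<μ↑v) (tightLabel-nonViolated (π v) (μ↑ w))

        μv≤t : μ v ≤L t
        μv≤t = ≤L-trans (to (¬loose⇔≤tightAt w≢v (μ∈ v)) (μ-noLoose v w vw)) (tightLabel-mono (π v) (μ≤μ↑ w))

        μ≤ν : μ ≤ν ν
        μ≤ν x = upd-elim (μ x ≤L_) μ↑ v t x (λ { refl → μv≤t }) (λ _ → μ≤μ↑ x)

    successor : Fin n → Fin n
    successor v with owner v
    ... | even = proj₁ μ↑-feasible v
    ... | odd = τ v

    successor-arc : ∀ v → Eτ v (successor v)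
    successor-nonViolated : ∀ v → NonViolatedAt (π v) (μ↑ v) (μ↑ (successor v))
    successor-arc v with owner v in eq
    ... | even = inj₁ (refl , proj₁ (proj₂ μ↑-feasible) v eq)
    ... | odd = inj₂ (refl , refl)
    successor-nonViolated v with owner v in eq
    ... | even = proj₂ (proj₂ (proj₂ μ↑-feasible)) v _ (inj₁ (eq , proj₁ (proj₂ μ↑-feasible) v eq)) (inj₂ (eq , refl))
    ... | odd = proj₂ (proj₂ (proj₂ μ↑-feasible)) v (τ v) (inj₂ (eq , refl)) (inj₁ eq)

    tightAt-successor≤ : ∀ v → tightAt μ↑ v (successor v) ≤L μ↑ v
    tightAt-successor≤ v = tightLabel-least (π v) (μ↑∈ v) (successor-nonViolated v)

    successor-finite : ∀ {v} → μ↑ v ≢ top → μ↑ (successor v) ≢ top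
    successor-finite {v} μ↑v≢top μ↑succ≡top =
      μ↑v≢top (NonViolatedAt-top⇒top (π v) (subst (NonViolatedAt (π v) (μ↑ v)) μ↑succ≡top (successor-nonViolated v)))

    module _ {R : Fin n → Fin n → Set} (R⇒successor : ∀ {x y} → R x y → y ≡ successor x) where

      μ↑-cut-step : ∀ k {y y'} → R y y' → k ≤ keep h (π y) → cut k (μ↑ y') ≤ᵗ cut k (μ↑ y)
      μ↑-cut-step k {y} r k≤ =
        subst (λ z → cut k (μ↑ z) ≤ᵗ _) (sym (R⇒successor r)) (NonViolatedAt-cut (π y) k k≤ (successor-nonViolated y))

      μ↑-cut-along : ∀ k {a b} (s : Star R a b) → All (λ y → k ≤ keep h (π y)) (sources s) →
                     cut k (μ↑ b) ≤ᵗ cut k (μ↑ a)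
      μ↑-cut-along k ε [] = inj₁ refl
      μ↑-cut-along k (r ◅ s) (k≤ ∷ ks) = ≤ᵗ-trans (μ↑-cut-along k s ks) (μ↑-cut-step k r k≤)

      μ↑-cut-along-strict : ∀ k {a b} (s : Star R a b) → All (λ y → k ≤ keep h (π y)) (sources s) → μ↑ a ≢ top →
                            Any (λ y → OddN (π y) × keep h (π y) ≡ k) (sources s) → cut k (μ↑ b) <ᵗ cut k (μ↑ a)
      μ↑-cut-along-strict k (_◅_ {i = y} r s) (_ ∷ ks) finite (here (πy-odd , refl)) =
        ≤ᵗ-<ᵗ-trans (μ↑-cut-along k s ks)
          (subst (λ z → cut k (μ↑ z) <ᵗ _) (sym (R⇒successor r))
            (NonViolatedAt-cut-odd (π y) πy-odd finite (successor-nonViolated y)))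
      μ↑-cut-along-strict k (r ◅ s) (k≤ ∷ ks) finite (there any) =
        <ᵗ-≤ᵗ-trans (μ↑-cut-along-strict k s ks (subst (λ z → μ↑ z ≢ top) (sym (R⇒successor r)) (successor-finite finite)) any)
                    (μ↑-cut-step k r k≤)

      μ↑-finite-along : ∀ {a b} (s : Star R a b) → μ↑ a ≢ top → All (λ y → μ↑ y ≢ top) (sources s) × μ↑ b ≢ top
      μ↑-finite-along = propagate λ r finite → subst (λ z → μ↑ z ≢ top) (sym (R⇒successor r)) (successor-finite finite)

    module _ {S : Fin n → Set} (S? : Decidable S) (Base⊆S : ∀ {v} → Base v → S v) where

      OutsideStep : Fin n → Fin n → Set
      OutsideStep x y = y ≡ successor x × ¬ S x × ¬ S y

      outsideStep⇒Eτ : ∀ {x y} → OutsideStep x y → Eτ x y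
      outsideStep⇒Eτ {x} (refl , _) = successor-arc x

      Bounded : ℕ → Fin n → Fin n → Set
      Bounded p = OutsideStep ↾ (λ y → π y ≤ p)

      -- A closed walk outside S through a node z of maximal priority p: for even p, z would be a base node;
      -- for odd p, μ↑ would strictly decrease around it at index p.
      no-closed-walk-at-max : ∀ {p z w} → π z ≡ p → μ↑ z ≢ top → Bounded p z w → Star (Bounded p) w z → ⊥
      no-closed-walk-at-max {p} {z} πz≡p finite r s with parity p
      ... | inj₁ p-even =
        proj₁ (proj₂ (proj₁ r)) (Base⊆S (closedWalk⇒Base p-even πz≡p (toEτ r) (Star.map toEτ s)))
        where
          toEτ : ∀ {x y} → Bounded p x y → (Eτ ↾ (λ y → π y ≤ p)) x y
          toEτ (x→y , bounds) = outsideStep⇒Eτ x→y , bounds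
      ... | inj₂ p-odd = <ᵗ-irrefl (μ↑-cut-along-strict (proj₁ ∘ proj₁) (keep h p) (r ◅ s)
                          (All-sources (λ r → keep-antitone h (proj₁ (proj₂ r))) (r ◅ s)) finite
                          (here (subst OddN (sym πz≡p) p-odd , cong (keep h) πz≡p)))

      no-closed-walk-outside : ∀ {x y} → μ↑ x ≢ top → OutsideStep x y → Star OutsideStep y x → ⊥
      no-closed-walk-outside {x} finite r s =
        let c = r ◅ s
            p = maxπ (sources c)
            c≤ = restrict c (maxπ-upperBound (sources c)) (All.head (maxπ-upperBound (sources c)))
            z , πz≡p , pre , _ , r' , suf =
              split-at-source c≤ (subst (Any (λ y → π y ≡ p)) (sym (sources-restrict c _ _)) (maxπ-attained x (sources s)))
        in no-closed-walk-at-max πz≡p (proj₂ (μ↑-finite-along (proj₁ ∘ proj₁) pre finite)) r' (suf ◅◅ pre)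

      ExitOrCycle : Fin n → Set
      ExitOrCycle u = (∃ λ x → Star OutsideStep u x × ¬ S x × S (successor x))
                    ⊎ (∃ λ x → Star OutsideStep u x × ∃ λ y → OutsideStep x y × Star OutsideStep y x)

      -- Follow successors from u, remembering the visited nodes vs (each of which reaches the current node x),
      -- until the walk leaves S or revisits a node.
      follow : ∀ k {u x} vs → Star OutsideStep u x → ¬ S x → Unique vs → x ∈ vs →
               (∀ {z} → z ∈ vs → Star OutsideStep z x) → n ≤ k + length vs → ExitOrCycle u
      follow k {x = x} vs w x∉S unique x∈vs back bound with S? (successor x)
      ... | yes exit = inj₁ (x , w , x∉S , exit)
      ... | no y∉S with Any.any? (successor x ≟_) vs
      ...   | yes y∈vs = inj₂ (x , w , successor x , (refl , x∉S , y∉S) , back y∈vs)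
      ...   | no y∉vs with k
      ...     | zero = ⊥-elim (ℕ.<-irrefl refl (ℕ.≤-trans (unique⇒length≤ (¬Any⇒All¬ vs y∉vs ∷ unique)) bound))
      ...     | suc k = follow k (successor x ∷ vs) (w ◅◅ (x→y ◅ ε)) y∉S (¬Any⇒All¬ vs y∉vs ∷ unique) (here refl)
                          back' (subst (n ≤_) (sym (ℕ.+-suc k (length vs))) bound)
        where
          x→y : OutsideStep x (successor x)
          x→y = refl , x∉S , y∉S
          back' : ∀ {z} → z ∈ successor x ∷ vs → Star OutsideStep z (successor x)
          back' (here refl) = ε
          back' (there z∈vs) = back z∈vs ◅◅ (x→y ◅ ε)

      exit-or-cycle : ∀ {u} → ¬ S u → ExitOrCycle u
      exit-or-cycle {u} u∉S =
        follow n (u ∷ []) ε u∉S ([] ∷ []) (here refl) (λ { (here refl) → ε }) (ℕ.m≤m+n n 1)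

      toHp : ∀ {p a b} → Star (Bounded p) a b → Star (Hp p) a b
      toHp = Star.map λ (x→y , bounds) → (outsideStep⇒Eτ x→y , proj₁ (proj₂ x→y) ∘ Base⊆S) , bounds

      -- Φ_p cannot increase along a walk outside S with priorities ≤ p. If it does not decrease, the walk lies
      -- in one strongly connected component of H_p, in which a node of priority p would be a base node.
      potential-level : ∀ {p u x} → EvenN p → 1 ≤ p → p ≤ d → (s : Star OutsideStep u x) → π u ≤ p →
                        All (λ y → π y ≤ p) (sources s) → Φ p u ≤ Φ p x →
                        Φ p u ≡ Φ p x × All (λ y → π y < p) (sources s)
      potential-level {p} {u} {x} p-even 1≤p p≤d s πu≤p bounds Φu≤Φx =
        Φu≡Φx , All.zipWith (λ (≤p , ≢p) → ℕ.≤∧≢⇒< ≤p ≢p) (bounds , ¬Any⇒All¬ (sources s) no-p)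
        where
          zero⇔ = proj₁ (potential p p-even 1≤p p≤d)
          monotone = proj₁ (proj₂ (potential p p-even 1≤p p≤d))
          scc⇔ = proj₂ (proj₂ (potential p p-even 1≤p p≤d))

          Φu≢0 : Φ p u ≢ 0
          Φu≢0 Φu≡0 = ℕ.<⇒≱ (to (zero⇔ u) Φu≡0) πu≤p

          πx≤p : π x ≤ p
          πx≤p with π x ℕ.≤? p
          ... | yes πx≤p = πx≤p
          ... | no πx≰p = ⊥-elim (Φu≢0 (ℕ.n≤0⇒n≡0 (subst (Φ p u ≤_) (from (zero⇔ x) (ℕ.≰⇒> πx≰p)) Φu≤Φx)))

          walk : Star (Hp p) u x
          walk = toHp (restrict s bounds πx≤p)

          Φu≡Φx : Φ p u ≡ Φ p x
          Φu≡Φx = ℕ.≤-antisym Φu≤Φx (monotone u x (πu≤p , πx≤p , walk))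

          back : Star (Hp p) x u
          back = proj₂ (proj₂ (proj₂ (to (scc⇔ u x) (Φu≡Φx , ℕ.n≢0⇒n>0 Φu≢0))))

          toEτ : ∀ {y z} → Hp p y z → (Eτ ↾ (λ y → π y ≤ p)) y z
          toEτ ((yz , _) , bounds) = yz , bounds

          no-p : ¬ Any (λ y → π y ≡ p) (sources s)
          no-p any =
            let y , πy≡p , pre , _ , r , suf = split-at-source walk
                  (subst (Any _) (sym (trans (sources-map _ (restrict s bounds πx≤p)) (sources-restrict s bounds πx≤p))) any)
            in proj₂ (proj₁ r) (closedWalk⇒Base p-even πy≡p (toEτ r) (Star.map toEτ (suf ◅◅ back ◅◅ pre)))

      module _ {u u₁ x} (r₀ : OutsideStep u u₁) (s₀ : Star OutsideStep u₁ x) {B C : Vec ℕ h}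
               (μ↑x≡B : μ↑ x ≡ leaf B) (μ↑u≡C : μ↑ u ≡ leaf C) where

        private
          walk : Star OutsideStep u x
          walk = r₀ ◅ s₀

          μ↑u-finite : μ↑ u ≢ top
          μ↑u-finite μ↑u≡top with trans (sym μ↑u≡C) μ↑u≡top
          ... | ()

        -- Below a common prefix P of B and C, at a level 2(m+1) that the walk does not reach.
        module NextComponent {m P b₀ b c₀ c} (len : length P + suc m ≡ h)
                             (B≡ : toList B ≡ P ++ b₀ ∷ b) (C≡ : toList C ≡ P ++ c₀ ∷ c)
                             (below : All (λ y → π y < 2 * suc m) (sources walk)) where

          private
            kept : All (λ y → suc (length P) ≤ keep h (π y)) (sources walk)
            kept = All.map (keep-below-level len) below

            cut-B : cut (suc (length P)) (μ↑ x) ≡ fin (P ++ b₀ ∷ [])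
            cut-B = trans (cong (cut _) μ↑x≡B) (cut-prefix P b₀ b B≡)

            cut-C : cut (suc (length P)) (μ↑ u) ≡ fin (P ++ c₀ ∷ [])
            cut-C = trans (cong (cut _) μ↑u≡C) (cut-prefix P c₀ c C≡)

          next-≤ : b₀ ≤ c₀
          next-≤ = ≤ₗ-head (++-cancelˡ-≤ₗ P (fin-≤ᵗ⁻ (subst₂ _≤ᵗ_ cut-B cut-C (μ↑-cut-along proj₁ _ walk kept))))

          next-< : Any (λ y → suc (π y) ≡ 2 * suc m) (sources walk) → b₀ < c₀
          next-< odd-node with ++-cancelˡ-<ₗ P (fin-<ᵗ⁻ (subst₂ _<ᵗ_ cut-B cut-C
                                 (μ↑-cut-along-strict proj₁ _ walk kept μ↑u-finite (Any.map odd-at-level odd-node))))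
            where
              odd-at-level : ∀ {y} → suc (π y) ≡ 2 * suc m → OddN (π y) × keep h (π y) ≡ suc (length P)
              odd-at-level e = subst OddN (sym (level-odd e)) (odd-double-suc m)
                             , trans (cong (keep h) (level-odd e)) (keep-odd-level len)
          ... | here b₀<c₀ = b₀<c₀

        potential-at-level : ∀ {m L} → L + suc m ≡ h → All (λ y → π y ≤ 2 * suc m) (sources walk) →
                             Φ (2 * suc m) u ≤ Φ (2 * suc m) x →
                             Φ (2 * suc m) u ≡ Φ (2 * suc m) x × All (λ y → π y < 2 * suc m) (sources walk)
        potential-at-level {m} {L} len bounds =
          potential-level (even-double (suc m)) 1≤p p≤d walk (All.head bounds) bounds
          where
            1≤p : 1 ≤ 2 * suc m
            1≤p = subst (1 ≤_) (sym (ℕ.*-suc 2 m)) (s≤s z≤n)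
            p≤d : 2 * suc m ≤ d
            p≤d = ℕ.*-monoʳ-≤ 2 (subst (suc m ≤_) len (ℕ.m≤n+m (suc m) L))

        -- Compare the keys of u and x level by level, from the top: P is the common prefix of B and C above
        -- level p = 2m, and a, b, c are the remaining components of ν(u), B and C.
        key-levels : ∀ m p → p ≡ 2 * m → (P : List ℕ) → length P + m ≡ h → (a b c : Vec ℕ m) →
                     toList B ≡ P ++ toList b → toList C ≡ P ++ toList c →
                     All (λ y → π y ≤ p) (sources walk) →
                     interleave u p a ≤ₗ interleave x p b → toList c <ₗ toList a → ⊥
        key-levels zero _ _ _ _ Vec.[] Vec.[] Vec.[] _ _ _ _ ()
        key-levels (suc m) p refl P len (a₀ Vec.∷ a) (b₀ Vec.∷ b) (c₀ Vec.∷ c) B≡ C≡ bounds keys c<a =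
          by-cases (Any.any? (λ y → suc (π y) ℕ.≟ p) (sources walk))
          where
            levels = potential-at-level len bounds (≤ₗ-head keys)

            open NextComponent len B≡ C≡ (proj₂ levels)

            keys' : (a₀ ∷ interleave u (p ∸ 2) a) ≤ₗ (b₀ ∷ interleave x (p ∸ 2) b)
            keys' = ≤ₗ-tail (subst (λ φ → (Φ p u ∷ a₀ ∷ interleave u (p ∸ 2) a) ≤ₗ (φ ∷ b₀ ∷ interleave x (p ∸ 2) b))
                              (sym (proj₁ levels)) keys)

            a₀≤b₀ : a₀ ≤ b₀
            a₀≤b₀ = ≤ₗ-head keys'

            c₀≤a₀ : c₀ ≤ a₀
            c₀≤a₀ = <ₗ-head c<a

            by-cases : Dec (Any (λ y → suc (π y) ≡ p) (sources walk)) → ⊥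
            by-cases (yes odd-node) = ℕ.<-irrefl refl (ℕ.<-≤-trans (next-< odd-node) (ℕ.≤-trans c₀≤a₀ a₀≤b₀))
            by-cases (no ¬odd-node) =
              key-levels m (p ∸ 2) (cong (_∸ 2) (ℕ.*-suc 2 m)) (P ++ a₀ ∷ []) len' a b c
                (prefix-step B≡ (sym a₀≡b₀)) (prefix-step C≡ c₀≡a₀) bounds'
                (≤ₗ-tail (subst (λ z → (a₀ ∷ interleave u (p ∸ 2) a) ≤ₗ (z ∷ interleave x (p ∸ 2) b)) (sym a₀≡b₀) keys'))
                (<ₗ-tail (subst (λ z → (z ∷ toList c) <ₗ (a₀ ∷ toList a)) c₀≡a₀ c<a))
              where
                a₀≡b₀ : a₀ ≡ b₀
                a₀≡b₀ = ℕ.≤-antisym a₀≤b₀ (ℕ.≤-trans next-≤ c₀≤a₀)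

                c₀≡a₀ : c₀ ≡ a₀
                c₀≡a₀ = ℕ.≤-antisym c₀≤a₀ (ℕ.≤-trans a₀≤b₀ next-≤)

                bounds' : All (λ y → π y ≤ p ∸ 2) (sources walk)
                bounds' = All.zipWith (λ (<p , ≢) → level-below <p ≢) (proj₂ levels , ¬Any⇒All¬ (sources walk) ¬odd-node)

                len' : length (P ++ a₀ ∷ []) + m ≡ h
                len' = trans (cong (_+ m) (List.length-++ P)) (trans (ℕ.+-assoc (length P) 1 m) len)

                prefix-step : ∀ {D : Vec ℕ h} {d₀ r} → toList D ≡ P ++ d₀ ∷ r → d₀ ≡ a₀ → toList D ≡ (P ++ a₀ ∷ []) ++ r
                prefix-step D≡ refl = trans D≡ (sym (List.++-assoc P _ _))

      exit-key : ∀ {ν u x} → Star OutsideStep u x → μ↑ u <L ν u → ν x ≡ μ↑ x → ¬ (key ν u ≤ᵗ key ν x)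
      exit-key ε μ↑u<νu νu≡μ↑u _ = <L⇒≱L μ↑u<νu (inj₁ (cong (cut h) νu≡μ↑u))
      exit-key {ν} {u} {x} w@(r₀ ◅ s₀) μ↑u<νu νx≡μ↑x key≤
        with finite⇒leaf (μ↑ u) (<L⇒≢top μ↑u<νu) | finite⇒leaf (μ↑ x) (proj₂ (μ↑-finite-along proj₁ w (<L⇒≢top μ↑u<νu)))
           | key-cases ν u | key-cases ν x
      ... | _ | _ | _ | inj₁ (νx≡top , _) = proj₂ (μ↑-finite-along proj₁ w (<L⇒≢top μ↑u<νu)) (trans (sym νx≡μ↑x) νx≡top)
      ... | _ | _ | inj₁ (_ , key-u) | inj₂ (_ , _ , key-x) with ∞≤ᵗ⇒≡∞ (subst₂ _≤ᵗ_ key-u key-x key≤)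
      ...   | ()
      exit-key {ν} {u} {x} (r₀ ◅ s₀) μ↑u<νu νx≡μ↑x key≤
        | C , μ↑u≡C | B , μ↑x≡B | inj₂ (A , νu≡A , key-u) | inj₂ (B' , νx≡B' , key-x) =
        key-levels r₀ s₀ μ↑x≡B μ↑u≡C h d refl [] refl A B C refl refl
          (All.tabulate λ {y} _ → proj₂ (π-bounds y)) keys C<A
        where
          B'≡B : B' ≡ B
          B'≡B = leaf-injective (trans (sym νx≡B') (trans νx≡μ↑x μ↑x≡B))

          keys : interleave u d A ≤ₗ interleave x d B
          keys = fin-≤ᵗ⁻ (subst₂ _≤ᵗ_ key-u (trans key-x (cong (fin ∘ interleave x d) B'≡B)) key≤)

          C<A : toList C <ₗ toList A
          C<A = subst₂ _<ₗ_ (take-toList C) (take-toList A)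
                  (fin-<ᵗ⁻ (subst₂ (λ c a → cut h c <ᵗ cut h a) μ↑u≡C νu≡A μ↑u<νu))

      settled : ∀ ν u → μ↑ ≤ν ν → (∀ {v w} → ¬ S v → S w → Eτ v w → ν v ≤L tightAt μ↑ v w) → ¬ S u →
                (∀ v → ¬ S v → key ν u ≤ᵗ key ν v) → ν u ≡ μ↑ u
      settled ν u μ↑≤ν into-S u∉S u-min with ≤L-total (ν u) (μ↑ u)
      ... | inj₁ νu≤μ↑u = ≤L-antisym νu≤μ↑u (μ↑≤ν u)
      ... | inj₂ μ↑u<νu with exit-or-cycle u∉S
      ...   | inj₂ (_ , walk , _ , r , s) =
        ⊥-elim (no-closed-walk-outside (proj₂ (μ↑-finite-along proj₁ walk (<L⇒≢top μ↑u<νu))) r s)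
      ...   | inj₁ (x , walk , x∉S , exit) = ⊥-elim (exit-key walk μ↑u<νu νx≡μ↑x (u-min x x∉S))
        where
          νx≡μ↑x : ν x ≡ μ↑ x
          νx≡μ↑x = ≤L-antisym (≤L-trans (into-S x∉S exit (successor-arc x)) (tightAt-successor≤ x)) (μ↑≤ν x)

    -- Correctness of every run

    record Invariant (added : List (Fin n)) (ν : Lab) : Set where
      field
        isLab : IsLab ν
        on-S : ∀ {v} → InS added v → ν v ≡ μ↑ v
        above : μ↑ ≤ν ν
        into-S : ∀ {v w} → ¬ InS added v → InS added w → Eτ v w → ν v ≤L tightAt μ↑ v w

    InS-∷⁻ : ∀ {added u w} → InS (u ∷ added) w → w ≡ u ⊎ InS added w
    InS-∷⁻ (inj₁ base) = inj₂ (inj₁ base)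
    InS-∷⁻ (inj₂ (here w≡u)) = inj₁ w≡u
    InS-∷⁻ (inj₂ (there w∈)) = inj₂ (inj₂ w∈)

    initial-invariant : ∀ {ν ν₁ as ν₂} → IsLab ν → (∀ v → Base v → ν v ≡ μ↑ v) → BaseRestriction ν ν₁ →
                        (∀ v w → ((v , w) ∈ as) ⇔ (Eτ v w × Base w × ¬ Base v)) → DropSeq ν₁ as ν₂ →
                        Invariant [] ν₂
    initial-invariant {ν} {ν₁} {as} {ν₂} ν∈ ν-on-base restriction as⇔ drops = record
      { isLab = dropSeq-isLab drops ν₁∈
      ; on-S = λ { (inj₁ base) → trans (dropSeq-unchanged drops (λ _ vw∈ → proj₂ (separated vw∈) base)) (ν₁-on-base base) }
      ; above = dropSeq-lower-bound drops ν₁∈ disjoint μ↑≤ν₁ μ↑≤tightAt-arc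
      ; into-S = λ { {v} {w} v∉S (inj₁ base) vw →
          subst (λ y → ν₂ v ≤L tightLabel (π v) y) (ν₁-on-base base)
            (dropSeq-≤tightAt drops disjoint (from (as⇔ v w) (vw , base , v∉S ∘ inj₁))) }
      }
      where
        separated : ∀ {v w} → (v , w) ∈ as → Base w × ¬ Base v
        separated {v} {w} = proj₂ ∘ to (as⇔ v w)

        disjoint : TargetsNotSources as
        disjoint = separated⇒targetsNotSources separated

        ν₁∈ : IsLab ν₁
        ν₁∈ = baseRestriction-isLab restriction ν∈

        ν₁-on-base : ∀ {v} → Base v → ν₁ v ≡ μ↑ v
        ν₁-on-base {v} base = trans (proj₁ (restriction v) base) (ν-on-base v base)

        μ↑≤ν₁ : μ↑ ≤ν ν₁
        μ↑≤ν₁ v with base? v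
        ... | yes base = inj₁ (cong (cut h) (sym (ν₁-on-base base)))
        ... | no ¬base = subst (μ↑ v ≤L_) (sym (proj₂ (restriction v) ¬base)) (≤L-top (μ↑ v))

        μ↑≤tightAt-arc : ∀ {v w} → (v , w) ∈ as → μ↑ v ≤L tightAt ν₁ v w
        μ↑≤tightAt-arc {v} {w} vw∈ =
          subst (λ y → μ↑ v ≤L tightLabel (π v) y) (sym (ν₁-on-base (proj₁ (separated vw∈))))
            (μ↑≤tightAt (proj₁ (to (as⇔ v w) vw∈)) λ { refl → proj₂ (separated vw∈) (proj₁ (separated vw∈)) })

    step-invariant : ∀ {added ν ν' u vs} → Invariant added ν → ¬ InS added u →
                     (∀ v → ¬ InS added v → key ν u ≤ᵗ key ν v) →
                     (∀ v → (v ∈ vs) ⇔ (Eτ v u × ¬ InS (u ∷ added) v)) → DropSeq ν (map (_, u) vs) ν' →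
                     Invariant (u ∷ added) ν'
    step-invariant {added} {ν} {ν'} {u} {vs} inv u∉S u-min vs⇔ drops = record
      { isLab = dropSeq-isLab drops isLab
      ; on-S = λ {v} v∈S' → trans (dropSeq-unchanged drops (λ _ vw∈ → proj₂ (separated vw∈) v∈S')) (ν-on-S' v∈S')
      ; above = dropSeq-lower-bound drops isLab disjoint above μ↑≤tightAt-arc
      ; into-S = into-S'
      }
      where
        open Invariant inv

        νu≡μ↑u : ν u ≡ μ↑ u
        νu≡μ↑u = settled (inS? added) inj₁ ν u above into-S u∉S u-min

        separated : ∀ {v w} → (v , w) ∈ map (_, u) vs → InS (u ∷ added) w × ¬ InS (u ∷ added) v
        separated = separated-into vs⇔

        disjoint : TargetsNotSources (map (_, u) vs)
        disjoint = separated⇒targetsNotSources separated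

        μ↑≤tightAt-arc : ∀ {v w} → (v , w) ∈ map (_, u) vs → μ↑ v ≤L tightAt ν v w
        μ↑≤tightAt-arc {v} vw∈ with ∈-map⁻ (_, u) vw∈
        ... | _ , v∈vs , refl =
          let vu , v∉S' = to (vs⇔ v) v∈vs in
          subst (λ y → μ↑ v ≤L tightLabel (π v) y) (sym νu≡μ↑u) (μ↑≤tightAt vu λ { refl → v∉S' (inj₂ (here refl)) })

        ν-on-S' : ∀ {v} → InS (u ∷ added) v → ν v ≡ μ↑ v
        ν-on-S' v∈S' with InS-∷⁻ v∈S'
        ... | inj₁ refl = νu≡μ↑u
        ... | inj₂ v∈S = on-S v∈S

        into-S' : ∀ {v w} → ¬ InS (u ∷ added) v → InS (u ∷ added) w → Eτ v w → ν' v ≤L tightAt μ↑ v w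
        into-S' {v} v∉S' w∈S' vw with InS-∷⁻ w∈S'
        ... | inj₁ refl = subst (λ y → ν' v ≤L tightLabel (π v) y) νu≡μ↑u
                            (dropSeq-≤tightAt drops disjoint (∈-map⁺ (_, u) (from (vs⇔ v) (vw , v∉S'))))
        ... | inj₂ w∈S = ≤L-trans (dropSeq-≤ drops v) (into-S (v∉S' ∘ InS-∷) w∈S vw)

    loop-correct : ∀ {added ν out} → Loop added ν out → Invariant added ν → ∀ v → out v ≡ μ↑ v
    loop-correct (done all-in-S) inv v = Invariant.on-S inv (all-in-S v)
    loop-correct (step u vs u∉S u-min _ vs⇔ drops loop) inv =
      loop-correct loop (step-invariant inv u∉S u-min vs⇔ drops)

    dijkstra-correct : ∀ {ν} → IsLab ν → (∀ v → Base v → ν v ≡ μ↑ v) → ∀ out → Dijkstra ν out → ∀ v → out v ≡ μ↑ v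
    dijkstra-correct ν∈ ν-on-base out (_ , restriction , _ , _ , as⇔ , _ , drops , loop) =
      loop-correct loop (initial-invariant ν∈ ν-on-base restriction as⇔ drops)

corollary5p4 : ∀ {n : ℕ} (h : ℕ) (E : Fin n → Fin n → Bool) (owner : Fin n → Player)
    (π : Fin n → ℕ) (τ : Fin n → Fin n) (T : List (Vec ℕ h))
    (Φ : ℕ → Fin n → ℕ) →
    let open Game h E owner π τ T Φ in
    (∀ v → ∃ λ w → E v w ≡ true) →
    (∀ v → 1 ≤ π v × π v ≤ d) →
    (∀ v → owner v ≡ odd → E v (τ v) ≡ true) →
    IsPotential →
    (μ : Lab) → IsLab μ →
    (∀ v w → Eτ v w → ¬ Loose μ v w) →
    (μ↑ : Lab) → IsLeastFeasibleAbove μ μ↑ →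
    (ν : Lab) → IsLab ν →
    (∀ v → Base v → ν v ≡ μ↑ v) →
    (∃ λ out → Dijkstra ν out)
    × (∀ out → Dijkstra ν out → ∀ v → out v ≡ μ↑ v)
corollary5p4 h E owner π τ T Φ _ π-bounds _ potential μ μ∈ μ-noLoose μ↑ μ↑-least ν ν∈ ν-on-base =
    dijkstra-exists h E owner π τ T Φ ν ν∈
  , dijkstra-correct h E owner π τ T Φ π-bounds potential μ∈ μ-noLoose μ↑-least ν∈ ν-on-base
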